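{- Let $b_m$ denote the $m$-th Bell number (the number of set partitions of $\{1,\dots,m\}$). (i) The Hopf algebras $\mathbf{CWSym}(b_1,b_2,b_3,\dots)$ and $\mathbf{WSym}_{(2)}$ are isomorphic. (ii) The Hopf algebras $\mathrm{C\Pi QSym}(b_1,b_2,b_3,\dots)$ and $\mathrm{\Pi QSym}_{(2)}$ are isomorphic.
   Context: For a sequence $a=(a_m)_{m\ge1}$ of nonnegative integers, a colored set partition of size $n$ associated to $a$ is a set $\Pi=\{[\pi_1,i_1],\dots,[\pi_k,i_k]\}$ with $\{\pi_1,\dots,\pi_k\}$ a set partition of $\{1,\dots,n\}$ and $1\le i_\ell\le a_{\#\pi_\ell}$. $\mathrm{std}$ replaces the $i$-th smallest integer occurring by $i$; for $\Pi$ of size $n$, $\Pi\uplus\Pi'=\Pi\cup\Pi'[n]$ ($\Pi'[n]$ adds $n$ to every integer of $\Pi'$). $\mathbf{CWSym}(a)$ is the Hopf algebra with basis $(\Phi_\Pi)$, product $\Phi_\Pi\Phi_{\Pi'}=\Phi_{\Pi\uplus\Pi'}$ and coproduct $\Delta(\Phi_\Pi)=\sum\Phi_{\mathrm{std}(\hat\Pi_1)}\otimes\Phi_{\mathrm{std}(\hat\Pi_2)}$ over ordered pairs $(\hat\Pi_1,\hat\Pi_2)$ of disjoint subsets of $\Pi$ with union $\Pi$; $\mathrm{C\Pi QSym}(a)$ is its graded dual. A set partition of level 2 of size $n$ is a set partition $\Pi$ of the set of blocks of some set partition $\pi$ of $\{1,\dots,n\}$. $\mathbf{WSym}_{(2)}$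 is the Hopf algebra with basis $(\Phi_\Pi)$ indexed by set partitions of level 2 (all sizes), product $\Phi_\Pi\Phi_{\Pi'}=\Phi_{\Pi\cup\Pi'[n]}$ for $\Pi$ of size $n$ (where $\Pi'[n]$ adds $n$ to every integer), and coproduct $\Delta(\Phi_\Pi)=\sum\Phi_{\mathrm{std}(\Pi')}\otimes\Phi_{\mathrm{std}(\Pi'')}$ over ordered pairs $(\Pi',\Pi'')$ of disjoint subsets of $\Pi$ with $\Pi'\cup\Pi''=\Pi$, where $\mathrm{std}$ replaces the $j$-th smallest integer occurring by $j$. $\mathrm{\Pi QSym}_{(2)}$ is its graded dual. -}

module Defs where

open import Data.Nat as ℕ using (ℕ; zero; suc; _∸_; _<?_)
open import Data.Rational as ℚ using (ℚ; 0ℚ; 1ℚ)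
open import Data.List using (List; []; _∷_; _++_; map; concatMap; length; sum; filter; upTo)
open import Data.List.Relation.Unary.All using (All)
open import Data.List.Membership.Propositional using (_∈_)
import Data.List.Properties as LP
import Data.Product.Properties as PP
open import Data.Product using (Σ; Σ-syntax; _×_; _,_; proj₁; proj₂)
open import Relation.Binary.PropositionalEquality using (_≡_)
open import Relation.Binary.Definitions using (DecidableEquality)
open import Relation.Nullary using (yes; no)

Comb : Set → Set
Comb B = List (ℚ × B)

module _ {B : Set} (_≟_ : DecidableEquality B) where

  coeff : B → Comb B → ℚ
  coeff b [] = 0ℚ
  coeff b ((c , x) ∷ xs) with x ≟ b
  ... | yes _ = c ℚ.+ coeff b xs
  ... | no  _ = coeff b xs

  _≈_ : Comb B → Comb B → Set
  xs ≈ ys = ∀ b → coeff b xs ≡ coeff b ys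

scale : {B : Set} → ℚ → Comb B → Comb B
scale c = map (λ p → (c ℚ.* proj₁ p , proj₂ p))

lin : {A B : Set} → (A → Comb B) → Comb A → Comb B
lin f = concatMap (λ p → scale (proj₁ p) (f (proj₂ p)))

lin₂ : {A B C : Set} → (A → B → Comb C) → Comb A → Comb B → Comb C
lin₂ f xs ys = concatMap (λ p → concatMap (λ q →
  scale (proj₁ p ℚ.* proj₁ q) (f (proj₂ p) (proj₂ q))) ys) xs

_⊗ˡ_ : {A B : Set} → (A → Comb B) → (A → Comb B) → Comb (A × A) → Comb (B × B)
(f ⊗ˡ g) = lin (λ ab → lin₂ (λ x y → (1ℚ , (x , y)) ∷ []) (f (proj₁ ab)) (g (proj₂ ab)))

-- A graded connected Hopf algebra presented by a combinatorial basis.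
-- Basis elements are the elements of `Raw` lying in `enum (size x)`
-- (enum n lists the basis elements of degree n, each exactly once).

record CHA : Set₁ where
  field
    Raw   : Set
    _≟_   : DecidableEquality Raw
    size  : Raw → ℕ
    enum  : ℕ → List Raw
    one   : Raw
    mul   : Raw → Raw → Comb Raw
    comul : Raw → Comb (Raw × Raw)

  Valid : Raw → Set
  Valid x = x ∈ enum (size x)

  _≟₂_ : DecidableEquality (Raw × Raw)
  _≟₂_ = PP.≡-dec _≟_ _≟_

  counit : Raw → ℚ
  counit x with x ≟ one
  ... | yes _ = 1ℚ
  ... | no  _ = 0ℚ

open CHA

-- Graded dual (basis: the dual basis F_x of the basis Φ_x)

dual : CHA → CHA
dual H = record
  { Raw = Raw H ; _≟_ = _≟_ H ; size = size H ; enum = enum H ; one = one H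
  ; mul = λ x y → map (λ z → (coeff (_≟₂_ H) (x , y) (comul H z) , z))
                      (enum H (size H x ℕ.+ size H y))
  ; comul = λ z → concatMap (λ k → concatMap (λ x → map
                    (λ y → (coeff (_≟_ H) z (mul H x y) , (x , y)))
                    (enum H (size H z ∸ k))) (enum H k)) (upTo (suc (size H z)))
  }

-- Hopf algebra isomorphisms (a bijective bialgebra morphism is a Hopf
-- algebra isomorphism; the antipode is then automatically preserved)

record IsHopfIso (H K : CHA) (f : Raw H → Comb (Raw K)) (g : Raw K → Comb (Raw H)) : Set where
  field
    f-supp  : ∀ x → Valid H x → All (λ p → Valid K (proj₂ p)) (f x)
    g-supp  : ∀ y → Valid K y → All (λ p → Valid H (proj₂ p)) (g y)
    unit    : _≈_ (_≟_ K) (f (one H)) ((1ℚ , one K) ∷ [])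
    mult    : ∀ x y → Valid H x → Valid H y →
              _≈_ (_≟_ K) (lin f (mul H x y)) (lin₂ (mul K) (f x) (f y))
    comult  : ∀ x → Valid H x →
              _≈_ (_≟₂_ K) ((f ⊗ˡ f) (comul H x)) (lin (comul K) (f x))
    counitP : ∀ x → Valid H x → coeff (_≟_ K) (one K) (f x) ≡ counit H x
    gf      : ∀ x → Valid H x → _≈_ (_≟_ H) (lin g (f x)) ((1ℚ , x) ∷ [])
    fg      : ∀ y → Valid K y → _≈_ (_≟_ K) (lin f (g y)) ((1ℚ , y) ∷ [])

HopfIsomorphic : CHA → CHA → Set
HopfIsomorphic H K = Σ[ f ∈ (Raw H → Comb (Raw K)) ] Σ[ g ∈ (Raw K → Comb (Raw H)) ] IsHopfIso H K f g

-- Set partitions of {1,…,n}: list of blocks, each block an increasing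
-- list, blocks ordered by their minima (a canonical representative).

insertions : ℕ → List (List ℕ) → List (List (List ℕ))
insertions m [] = []
insertions m (b ∷ bs) = ((b ++ (m ∷ [])) ∷ bs) ∷ map (b ∷_) (insertions m bs)

SetPartitions : ℕ → List (List (List ℕ))
SetPartitions zero = [] ∷ []
SetPartitions (suc n) =
  concatMap (λ π → (π ++ ((suc n ∷ []) ∷ [])) ∷ insertions (suc n) π) (SetPartitions n)

bell : ℕ → ℕ
bell m = length (SetPartitions m)

splits : {A : Set} → List A → List (List A × List A)
splits [] = ([] , []) ∷ []
splits (a ∷ as) = concatMap (λ p → (a ∷ proj₁ p , proj₂ p) ∷ (proj₁ p , a ∷ proj₂ p) ∷ []) (splits as)

rank : List ℕ → ℕ → ℕ
rank ints i = suc (length (filter (_<? i) ints))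

-- CWSym(a): colored set partitions, a block of size m carries a color
-- 1 ≤ i ≤ a m.

CRaw : Set
CRaw = List (List ℕ × ℕ)

colorings : (ℕ → ℕ) → List (List ℕ) → List CRaw
colorings a [] = [] ∷ []
colorings a (b ∷ bs) =
  concatMap (λ i → map ((b , suc i) ∷_) (colorings a bs)) (upTo (a (length b)))

cints : CRaw → List ℕ
cints = concatMap proj₁

cstd : CRaw → CRaw
cstd Π = map (λ p → (map (rank (cints Π)) (proj₁ p) , proj₂ p)) Π

cshift : ℕ → CRaw → CRaw
cshift n = map (λ p → (map (n ℕ.+_) (proj₁ p) , proj₂ p))

CWSym : (ℕ → ℕ) → CHA
CWSym a = record
  { Raw = CRaw
  ; _≟_ = LP.≡-dec (PP.≡-dec (LP.≡-dec ℕ._≟_) ℕ._≟_)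
  ; size = λ Π → length (cints Π)
  ; enum = λ n → concatMap (colorings a) (SetPartitions n)
  ; one = []
  ; mul = λ Π Π' → (1ℚ , Π ++ cshift (length (cints Π)) Π') ∷ []
  ; comul = λ Π → map (λ p → (1ℚ , (cstd (proj₁ p) , cstd (proj₂ p)))) (splits Π)
  }

CΠQSym : (ℕ → ℕ) → CHA
CΠQSym a = dual (CWSym a)

-- WSym_(2): set partitions of level 2.  Represented as the list of
-- blocks of Π, each being a list of blocks of π (canonical order: blocks
-- of π inside a block of Π ordered by minima, blocks of Π ordered by
-- minima as a set partition of the blocks of π ordered by minima).

LRaw : Set
LRaw = List (List (List ℕ))

-- i-th block (1-based) of a set partition
blockAt : List (List ℕ) → ℕ → List ℕ
blockAt [] i = []
blockAt (b ∷ bs) zero = []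
blockAt (b ∷ bs) (suc zero) = b
blockAt (b ∷ bs) (suc (suc i)) = blockAt bs (suc i)

level2 : ℕ → List LRaw
level2 n = concatMap (λ π → map (map (map (blockAt π))) (SetPartitions (length π)))
                     (SetPartitions n)

lints : LRaw → List ℕ
lints = concatMap (concatMap (λ b → b))

lstd : LRaw → LRaw
lstd Π = map (map (map (rank (lints Π)))) Π

lshift : ℕ → LRaw → LRaw
lshift n = map (map (map (n ℕ.+_)))

WSym₂ : CHA
WSym₂ = record
  { Raw = LRaw
  ; _≟_ = LP.≡-dec (LP.≡-dec (LP.≡-dec ℕ._≟_))
  ; size = λ Π → length (lints Π)
  ; enum = level2
  ; one = []
  ; mul = λ Π Π' → (1ℚ , Π ++ lshift (length (lints Π)) Π') ∷ []
  ; comul = λ Π → map (λ p → (1ℚ , (lstd (proj₁ p) , lstd (proj₂ p)))) (splits Π)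
  }

ΠQSym₂ : CHA
ΠQSym₂ = dual WSym₂

-- A colored block (S , i) of CWSym(b) is a set S together with one of the b_|S| set partitions of
-- {1, …, |S|}; carried over to S along the increasing bijection, that set partition splits S into
-- blocks.  Doing this for every block of a colored set partition of {1, …, n} produces a set partition π
-- of {1, …, n} together with a set partition of the blocks of π, i.e. a set partition of level 2, and
-- every set partition of level 2 arises exactly once.  This bijection of bases commutes with shifting,
-- with concatenation and with standardization, because all three act on the underlying integers only
-- and the relabelling is order preserving.  Hence it respects products and coproducts, and being a
-- bijection of bases that preserves all structure constants, it also respects those of the graded duals.

module Submission where

open import Defs
open import Data.Nat as ℕ using (ℕ; zero; suc; _+_; _∸_; _<_; _≤_; _<?_; z≤n; s≤s; pred)
import Data.Nat.Properties as NP
open import Data.Rational as ℚ using (ℚ; 0ℚ; 1ℚ)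
import Data.Rational.Properties as QP
open import Algebra.Bundles using (CommutativeMonoid)
open import Algebra.Properties.CommutativeSemigroup (CommutativeMonoid.commutativeSemigroup QP.+-0-commutativeMonoid)
  using (x∙yz≈y∙xz)
open import Data.List using (List; []; _∷_; _++_; map; concatMap; concat; length; filter; upTo; [_])
import Data.List.Properties as LP
import Data.List.Sort NP.≤-decTotalOrder as Sort
open import Data.List.Relation.Unary.All as All using (All; []; _∷_)
import Data.List.Relation.Unary.All.Properties as AllP
open import Data.List.Relation.Unary.Any using (here; there)
open import Data.List.Relation.Unary.AllPairs as AP using (AllPairs; []; _∷_)
import Data.List.Relation.Unary.AllPairs.Properties as APP
open import Data.List.Relation.Unary.Linked.Properties using (Linked⇒AllPairs; AllPairs⇒Linked)
open import Data.List.Relation.Unary.Sorted.TotalOrder.Properties using (↗↭↗⇒≋)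
open import Data.List.Relation.Binary.Pointwise using (Pointwise-≡⇒≡)
open import Data.List.Relation.Unary.Unique.Propositional using (Unique)
import Data.List.Relation.Unary.Unique.Propositional.Properties as UP
open import Data.List.Membership.Propositional using (_∈_; find; lose)
open import Data.List.Membership.Propositional.Properties
  using (∈-map⁺; ∈-map⁻; ∈-++⁺ˡ; ∈-++⁺ʳ; ∈-++⁻; ∈-concat⁺′; ∈-concat⁻′; ∈-concatMap⁺; ∈-concatMap⁻; ∈-upTo⁺; ∈-upTo⁻)
open import Data.List.Membership.Propositional.Properties.WithK using (unique∧set⇒bag)
open import Data.List.Relation.Binary.Disjoint.Propositional using (Disjoint)
open import Data.List.Relation.Binary.BagAndSetEquality using (∼bag⇒↭)
open import Data.List.Relation.Binary.Permutation.Propositional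
  using (_↭_; ↭-refl; ↭-sym; ↭-trans; ↭-reflexive; prep; swap; ↭⇒↭ₛ; module PermutationReasoning)
import Data.List.Relation.Binary.Permutation.Propositional.Properties as PermP
import Data.List.Relation.Binary.Permutation.Setoid.Properties as PermS
open import Data.Product using (Σ-syntax; _×_; _,_; proj₁; proj₂)
open import Data.Sum using (inj₁; inj₂)
open import Data.Empty using (⊥; ⊥-elim)
open import Function.Bundles using (mk⇔)
open import Relation.Nullary using (yes; no; ¬_)
open import Relation.Binary.Definitions using (DecidableEquality)
open import Relation.Binary.PropositionalEquality
  using (_≡_; _≢_; refl; sym; trans; cong; cong₂; subst; subst₂; setoid; module ≡-Reasoning)

map-cong-∈ : ∀ {A B : Set} {f g : A → B} (xs : List A) → (∀ {a} → a ∈ xs → f a ≡ g a) → map f xs ≡ map g xs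
map-cong-∈ xs h = LP.map-cong-local (All.tabulate h)

map-id-∈ : ∀ {A : Set} {f : A → A} (L : List A) → (∀ {a} → a ∈ L → f a ≡ a) → map f L ≡ L
map-id-∈ L h = trans (map-cong-∈ L h) (LP.map-id L)

map-map-id-∈ : ∀ {A : Set} {f : A → A} (P : List (List A)) → (∀ {v} → v ∈ concat P → f v ≡ v) → map (map f) P ≡ P
map-map-id-∈ P h = map-id-∈ P (λ b∈ → map-id-∈ _ (λ v∈ → h (∈-concat⁺′ v∈ b∈)))

data NonEmpty {A : Set} : List A → Set where
  ne : ∀ {x xs} → NonEmpty (x ∷ xs)

∈⇒NonEmpty : ∀ {A : Set} {v : A} {L} → v ∈ L → NonEmpty L
∈⇒NonEmpty (here _) = ne
∈⇒NonEmpty (there _) = ne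

AllPairs-++⁻ʳ : ∀ {A : Set} {R : A → A → Set} xs {ys} → AllPairs R (xs ++ ys) → AllPairs R ys
AllPairs-++⁻ʳ [] a = a
AllPairs-++⁻ʳ (x ∷ xs) (_ ∷ a) = AllPairs-++⁻ʳ xs a

AllPairs-++⁻ˡ : ∀ {A : Set} {R : A → A → Set} xs {ys} → AllPairs R (xs ++ ys) → AllPairs R xs
AllPairs-++⁻ˡ [] a = []
AllPairs-++⁻ˡ (x ∷ xs) (h ∷ a) = AllP.++⁻ˡ xs h ∷ AllPairs-++⁻ˡ xs a

AllPairs-map-∈ : ∀ {A : Set} {R S : A → A → Set} xs → AllPairs R xs → (∀ {x y} → x ∈ xs → y ∈ xs → R x y → S x y) → AllPairs S xs
AllPairs-map-∈ [] [] f = []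
AllPairs-map-∈ (x ∷ xs) (a ∷ p) f =
  All.tabulate (λ y∈ → f (here refl) (there y∈) (All.lookup a y∈)) ∷ AllPairs-map-∈ xs p (λ x∈ y∈ → f (there x∈) (there y∈))

All-middle⁻ : ∀ {A : Set} {Q : A → Set} pre {b} post → All Q (pre ++ b ∷ post) → All Q pre × Q b × All Q post
All-middle⁻ pre post a with AllP.++⁻ pre a
... | a1 , (qb ∷ a2) = a1 , qb , a2

All-middle⁺ : ∀ {A : Set} {Q : A → Set} pre {b} post → All Q pre → Q b → All Q post → All Q (pre ++ b ∷ post)
All-middle⁺ pre post a1 qb a2 = AllP.++⁺ a1 (qb ∷ a2)

concat-mid : ∀ {A : Set} (pre : List (List A)) b post → concat (pre ++ b ∷ post) ≡ concat pre ++ b ++ concat post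
concat-mid pre b post = sym (LP.concat-++ pre (b ∷ post))

∈-middle : ∀ {A : Set} (pre : List (List A)) {b} post {v} → v ∈ b → v ∈ concat (pre ++ b ∷ post)
∈-middle pre {b} post {v} v∈b = subst (v ∈_) (sym (concat-mid pre b post)) (∈-++⁺ʳ (concat pre) (∈-++⁺ˡ v∈b))

∈-concat⇒split : ∀ {A : Set} {v : A} P → v ∈ concat P →
                 Σ[ pre ∈ List (List A) ] Σ[ b ∈ List A ] Σ[ post ∈ List (List A) ] (P ≡ pre ++ b ∷ post × v ∈ b)
∈-concat⇒split (b ∷ P) m with ∈-++⁻ b m
... | inj₁ m' = [] , b , P , refl , m'
... | inj₂ m' with ∈-concat⇒split P m'
... | pre , c , post , e , mc = b ∷ pre , c , post , cong (b ∷_) e , mc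

Unique-++⇒disjoint : ∀ {A : Set} (xs : List A) {ys} {v} → Unique (xs ++ ys) → v ∈ xs → v ∈ ys → ⊥
Unique-++⇒disjoint (x ∷ xs) (a ∷ u) (here refl) vy = All.lookup (AllP.++⁻ʳ xs a) vy refl
Unique-++⇒disjoint (x ∷ xs) (a ∷ u) (there vx) vy = Unique-++⇒disjoint xs u vx vy

increasing⇒sorted : ∀ {xs} → AllPairs _<_ xs → AllPairs _≤_ xs
increasing⇒sorted = AP.map NP.<⇒≤

increasing⇒unique : ∀ {xs} → AllPairs _<_ xs → Unique xs
increasing⇒unique = AP.map (λ l e → NP.<-irrefl e l)

sorted∧unique⇒increasing : ∀ {xs} → AllPairs _≤_ xs → Unique xs → AllPairs _<_ xs
sorted∧unique⇒increasing s u = AP.zipWith (λ (l , n) → NP.≤∧≢⇒< l n) (s , u)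

Unique-resp-↭ : ∀ {A : Set} {xs ys : List A} → xs ↭ ys → Unique xs → Unique ys
Unique-resp-↭ p = PermS.Unique-resp-↭ (setoid _) (↭⇒↭ₛ p)

Unique-concat⁻ : ∀ {A : Set} (L : List (List A)) → Unique (concat L) → All (Unique) L
Unique-concat⁻ [] u = []
Unique-concat⁻ (b ∷ L) u = AllPairs-++⁻ˡ b u ∷ Unique-concat⁻ L (AllPairs-++⁻ʳ b u)

Unique-map⁺-∈ : ∀ {A C : Set} (f : A → C) L → Unique L → (∀ {x y} → x ∈ L → y ∈ L → f x ≡ f y → x ≡ y) → Unique (map f L)
Unique-map⁺-∈ f [] [] inj = []
Unique-map⁺-∈ f (x ∷ L) (a ∷ u) inj =
  AllP.map⁺ (All.tabulate (λ {y} ym e → All.lookup a ym (inj (here refl) (there ym) e)))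
  ∷ Unique-map⁺-∈ f L u (λ xm ym e → inj (there xm) (there ym) e)

∷ʳ-length≢ : ∀ {A : Set} (xs : List A) {x ys} → length ys ≡ length xs → xs ++ [ x ] ≢ ys
∷ʳ-length≢ xs {x} l e = NP.1+n≢n (trans (sym (LP.length-++-comm xs [ x ])) (trans (cong length e) l))

∷ʳ-cancel-↭ : ∀ {A : Set} {xs ys : List A} {m} → xs ++ [ m ] ↭ ys ++ [ m ] → xs ↭ ys
∷ʳ-cancel-↭ {xs = xs} {ys} p = subst₂ _↭_ (LP.++-identityʳ xs) (LP.++-identityʳ ys) (PermP.drop-mid xs ys p)

concat-↭ : ∀ {A : Set} {L L' : List (List A)} → L ↭ L' → concat L ↭ concat L'
concat-↭ _↭_.refl = ↭-refl
concat-↭ (prep x p) = PermP.++⁺ˡ x (concat-↭ p)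
concat-↭ (swap x y p) = ↭-trans (PermP.shifts x y) (PermP.++⁺ˡ y (PermP.++⁺ˡ x (concat-↭ p)))
concat-↭ (_↭_.trans p q) = ↭-trans (concat-↭ p) (concat-↭ q)

concatMap-↭-pointwise : ∀ {A B : Set} (f g : A → List B) L → (∀ {a} → a ∈ L → f a ↭ g a) → concatMap f L ↭ concatMap g L
concatMap-↭-pointwise f g [] h = ↭-refl
concatMap-↭-pointwise f g (a ∷ L) h = PermP.++⁺ (h (here refl)) (concatMap-↭-pointwise f g L (λ m → h (there m)))

concatMap-↭ : ∀ {A C : Set} (f : A → List C) {L L'} → L ↭ L' → concatMap f L ↭ concatMap f L'
concatMap-↭ f p = concat-↭ (PermP.map⁺ f p)

concatMap-single : ∀ {A C : Set} (h : A → C) L → concatMap (λ a → h a ∷ []) L ≡ map h L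
concatMap-single h [] = refl
concatMap-single h (a ∷ L) = cong (h a ∷_) (concatMap-single h L)

splitStep : ∀ {A : Set} → A → List A × List A → List (List A × List A)
splitStep a p = (a ∷ proj₁ p , proj₂ p) ∷ (proj₁ p , a ∷ proj₂ p) ∷ []

mapBoth : ∀ {A B : Set} → (A → B) → List A × List A → List B × List B
mapBoth f p = (map f (proj₁ p) , map f (proj₂ p))

splits-map : ∀ {A B : Set} (f : A → B) xs → splits (map f xs) ≡ map (mapBoth f) (splits xs)
splits-map f [] = refl
splits-map f (a ∷ as) = begin
    concatMap (splitStep (f a)) (splits (map f as))
  ≡⟨ cong (concatMap (splitStep (f a))) (splits-map f as) ⟩
    concatMap (splitStep (f a)) (map (mapBoth f) (splits as))
  ≡⟨ LP.concatMap-map (splitStep (f a)) (mapBoth f) (splits as) ⟩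
    concatMap (λ p → map (mapBoth f) (splitStep a p)) (splits as)
  ≡⟨ LP.map-concatMap (mapBoth f) (splitStep a) (splits as) ⟨
    map (mapBoth f) (concatMap (splitStep a) (splits as)) ∎
  where open ≡-Reasoning

All-splits : ∀ {A : Set} {Q : A → Set} xs → All Q xs → ∀ {p} → p ∈ splits xs → All Q (proj₁ p) × All Q (proj₂ p)
All-splits [] [] (here refl) = [] , []
All-splits (a ∷ as) (qa ∷ q) p∈ with find (∈-concatMap⁻ (splitStep a) {xs = splits as} p∈)
... | _ , p′∈ , here refl = qa ∷ proj₁ (All-splits as q p′∈) , proj₂ (All-splits as q p′∈)
... | _ , p′∈ , there (here refl) = proj₁ (All-splits as q p′∈) , qa ∷ proj₂ (All-splits as q p′∈)

interval : ℕ → ℕ → List ℕ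
interval a zero = []
interval a (suc n) = a ∷ interval (suc a) n

interval-suc : ∀ a n → interval (suc a) n ≡ map suc (interval a n)
interval-suc a zero = refl
interval-suc a (suc n) = cong (suc a ∷_) (interval-suc (suc a) n)

interval-snoc : ∀ a n → interval a (suc n) ≡ interval a n ++ [ a + n ]
interval-snoc a zero = cong (λ k → k ∷ []) (sym (NP.+-identityʳ a))
interval-snoc a (suc n) = cong (a ∷_) (trans (interval-snoc (suc a) n) (cong (λ k → interval (suc a) n ++ [ k ]) (sym (NP.+-suc a n))))

∈-interval⁻ : ∀ {k} a n → k ∈ interval a n → a ≤ k × k < a + n
∈-interval⁻ {k} a zero ()
∈-interval⁻ a (suc n) (here refl) = NP.≤-refl , subst (a <_) (sym (NP.+-suc a n)) (s≤s (NP.m≤m+n a n))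
∈-interval⁻ {k} a (suc n) (there p) with ∈-interval⁻ (suc a) n p
... | l , u = NP.<⇒≤ l , subst (λ t → k < t) (sym (NP.+-suc a n)) u

∈-interval⁺ : ∀ {k} a n → a ≤ k → k < a + n → k ∈ interval a n
∈-interval⁺ {k} a zero l u = ⊥-elim (NP.<-irrefl refl (NP.<-≤-trans u (subst (_≤ k) (sym (NP.+-identityʳ a)) l)))
∈-interval⁺ {k} a (suc n) l u with a ℕ.≟ k
... | yes refl = here refl
... | no a≢k = there (∈-interval⁺ (suc a) n (NP.≤∧≢⇒< l a≢k) (subst (k <_) (NP.+-suc a n) u))

interval-increasing : ∀ a n → AllPairs _<_ (interval a n)
interval-increasing a zero = []
interval-increasing a (suc n) = All.tabulate (λ k∈ → proj₁ (∈-interval⁻ (suc a) n k∈)) ∷ interval-increasing (suc a) n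

∈-interval₁-bounds : ∀ {k j} → j ∈ interval 1 k → 1 ≤ j × j ≤ k
∈-interval₁-bounds {k} jm with ∈-interval⁻ 1 k jm
... | l , u = l , NP.≤-pred u

∈-↭-interval₁ : ∀ {m xs v} → xs ↭ interval 1 m → v ∈ xs → 1 ≤ v × v < suc m
∈-↭-interval₁ {m} p vm = ∈-interval⁻ 1 m (PermP.∈-resp-↭ p vm)

↭-interval⇒unique : ∀ {xs a n} → xs ↭ interval a n → Unique xs
↭-interval⇒unique {a = a} {n} p = Unique-resp-↭ (↭-sym p) (increasing⇒unique (interval-increasing a n))

module _ {A : Set} where

  lookupClamped : A → List A → ℕ → A
  lookupClamped x [] k = x
  lookupClamped x (y ∷ ys) zero = x
  lookupClamped x (y ∷ ys) (suc k) = lookupClamped y ys k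

  -- 1-based lookup; indices out of range give the first or last entry, and d only for the empty list.
  lookup₁ : A → List A → ℕ → A
  lookup₁ d [] k = d
  lookup₁ d (x ∷ xs) k = lookupClamped x xs (pred k)

  lookupClamped-∈ : ∀ x xs k → lookupClamped x xs k ∈ x ∷ xs
  lookupClamped-∈ x [] k = here refl
  lookupClamped-∈ x (y ∷ ys) zero = here refl
  lookupClamped-∈ x (y ∷ ys) (suc k) = there (lookupClamped-∈ y ys k)

  map-lookupClamped-interval : ∀ x xs → map (lookupClamped x xs) (interval 0 (suc (length xs))) ≡ x ∷ xs
  map-lookupClamped-interval x [] = refl
  map-lookupClamped-interval x (y ∷ ys) = cong (x ∷_) (begin
      map (lookupClamped x (y ∷ ys)) (interval 1 (suc (length ys)))
    ≡⟨ cong (map (lookupClamped x (y ∷ ys))) (interval-suc 0 (suc (length ys))) ⟩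
      map (lookupClamped x (y ∷ ys)) (map suc (interval 0 (suc (length ys))))
    ≡⟨ sym (LP.map-∘ (interval 0 (suc (length ys)))) ⟩
      map (lookupClamped y ys) (interval 0 (suc (length ys)))
    ≡⟨ map-lookupClamped-interval y ys ⟩
      y ∷ ys ∎)
    where open ≡-Reasoning

  map-lookup₁-interval : ∀ d L → map (lookup₁ d L) (interval 1 (length L)) ≡ L
  map-lookup₁-interval d [] = refl
  map-lookup₁-interval d (x ∷ xs) = begin
      map (lookup₁ d (x ∷ xs)) (interval 1 (suc (length xs)))
    ≡⟨ cong (map (lookup₁ d (x ∷ xs))) (interval-suc 0 (suc (length xs))) ⟩
      map (lookup₁ d (x ∷ xs)) (map suc (interval 0 (suc (length xs))))
    ≡⟨ sym (LP.map-∘ (interval 0 (suc (length xs)))) ⟩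
      map (lookupClamped x xs) (interval 0 (suc (length xs)))
    ≡⟨ map-lookupClamped-interval x xs ⟩
      x ∷ xs ∎
    where open ≡-Reasoning

module _ {A B : Set} (h : A → B) where
  lookupClamped-map : ∀ x xs k → lookupClamped (h x) (map h xs) k ≡ h (lookupClamped x xs k)
  lookupClamped-map x [] k = refl
  lookupClamped-map x (y ∷ ys) zero = refl
  lookupClamped-map x (y ∷ ys) (suc k) = lookupClamped-map y ys k

module _ {A : Set} (_≟_ : DecidableEquality A) where

  -- 0-based index of the first occurrence (length L if there is none).
  position₀ : List A → A → ℕ
  position₀ [] a = 0
  position₀ (x ∷ xs) a with x ≟ a
  ... | yes _ = 0
  ... | no _ = suc (position₀ xs a)

  position : List A → A → ℕ
  position L a = suc (position₀ L a)

  lookupClamped-position₀ : ∀ x xs a → a ∈ x ∷ xs → lookupClamped x xs (position₀ (x ∷ xs) a) ≡ a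
  lookupClamped-position₀ x xs a m with x ≟ a
  lookupClamped-position₀ x [] a m | yes e = e
  lookupClamped-position₀ x (y ∷ ys) a m | yes e = e
  lookupClamped-position₀ x [] a (here e) | no x≢a = ⊥-elim (x≢a (sym e))
  lookupClamped-position₀ x (y ∷ ys) a (here e) | no x≢a = ⊥-elim (x≢a (sym e))
  lookupClamped-position₀ x (y ∷ ys) a (there m) | no x≢a = lookupClamped-position₀ y ys a m

  lookup₁-position : ∀ d L a → a ∈ L → lookup₁ d L (position L a) ≡ a
  lookup₁-position d (x ∷ xs) a m = lookupClamped-position₀ x xs a m

  position₀-there : ∀ x xs a → x ≢ a → position₀ (x ∷ xs) a ≡ suc (position₀ xs a)
  position₀-there x xs a x≢a with x ≟ a
  ... | yes e = ⊥-elim (x≢a e)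
  ... | no _ = refl

  position₀-here : ∀ x xs → position₀ (x ∷ xs) x ≡ 0
  position₀-here x xs with x ≟ x
  ... | yes _ = refl
  ... | no x≢x = ⊥-elim (x≢x refl)

  map-position₀-self : ∀ L → Unique L → map (position₀ L) L ≡ interval 0 (length L)
  map-position₀-self [] u = refl
  map-position₀-self (x ∷ xs) (nx ∷ u) = cong₂ _∷_ (position₀-here x xs) (begin
      map (position₀ (x ∷ xs)) xs
    ≡⟨ map-cong-∈ xs (λ {a} a∈ → position₀-there x xs a (All.lookup nx a∈)) ⟩
      map (λ a → suc (position₀ xs a)) xs
    ≡⟨ LP.map-∘ xs ⟩
      map suc (map (position₀ xs) xs)
    ≡⟨ cong (map suc) (map-position₀-self xs u) ⟩
      map suc (interval 0 (length xs))
    ≡⟨ sym (interval-suc 0 (length xs)) ⟩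
      interval 1 (length xs) ∎)
    where open ≡-Reasoning

  position₀-lookupClamped : ∀ x xs j → Unique (x ∷ xs) → j < suc (length xs) → position₀ (x ∷ xs) (lookupClamped x xs j) ≡ j
  position₀-lookupClamped x [] zero u l = position₀-here x []
  position₀-lookupClamped x (y ∷ ys) zero u l = position₀-here x (y ∷ ys)
  position₀-lookupClamped x [] (suc j) u (s≤s ())
  position₀-lookupClamped x (y ∷ ys) (suc j) (nx ∷ u) (s≤s l) =
    trans (position₀-there x (y ∷ ys) (lookupClamped y ys j) (λ e → All.lookup nx (lookupClamped-∈ y ys j) e))
          (cong suc (position₀-lookupClamped y ys j u l))

module _ {A : Set} (_≟_ : DecidableEquality A) (key : A → ℕ) where

  SortedBy : List A → Set
  SortedBy = AllPairs (λ a b → key a < key b)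

  SortedBy⇒unique : ∀ {L} → SortedBy L → Unique L
  SortedBy⇒unique = AP.map (λ {a} {b} k e → NP.<-irrefl (cong key e) k)

  position₀-monotone : ∀ L → SortedBy L → ∀ {a b} → a ∈ L → b ∈ L → key a < key b → position₀ _≟_ L a < position₀ _≟_ L b
  position₀-monotone (x ∷ xs) (ax ∷ s) {a} {b} (here refl) (here refl) k = ⊥-elim (NP.<-irrefl refl k)
  position₀-monotone (x ∷ xs) (ax ∷ s) {a} {b} (here refl) (there bm) k
    rewrite position₀-here _≟_ x xs | position₀-there _≟_ x xs b (λ e → NP.<-irrefl (cong key e) k) = s≤s z≤n
  position₀-monotone (x ∷ xs) (ax ∷ s) {a} {b} (there am) (here refl) k =
    ⊥-elim (NP.<-asym k (All.lookup ax am))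
  position₀-monotone (x ∷ xs) (ax ∷ s) {a} {b} (there am) (there bm) k
    rewrite position₀-there _≟_ x xs a (λ e → NP.<-irrefl (cong key e) (All.lookup ax am))
          | position₀-there _≟_ x xs b (λ e → NP.<-irrefl (cong key e) (All.lookup ax bm)) =
    s≤s (position₀-monotone xs s am bm k)

  lookupClamped-monotone : ∀ x xs → SortedBy (x ∷ xs) → ∀ i j → i < j → j < suc (length xs) → key (lookupClamped x xs i) < key (lookupClamped x xs j)
  lookupClamped-monotone x [] s i zero () u
  lookupClamped-monotone x [] s i (suc j) l (s≤s ())
  lookupClamped-monotone x (y ∷ ys) s i zero () u
  lookupClamped-monotone x (y ∷ ys) (ax ∷ s) zero (suc j) l u = All.lookup ax (lookupClamped-∈ y ys j)
  lookupClamped-monotone x (y ∷ ys) (ax ∷ s) (suc i) (suc j) (s≤s l) (s≤s u) = lookupClamped-monotone y ys s i j l u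

sorted-↭⇒≡ : ∀ {xs ys} → AllPairs _≤_ xs → AllPairs _≤_ ys → xs ↭ ys → xs ≡ ys
sorted-↭⇒≡ sx sy p =
  Pointwise-≡⇒≡ (↗↭↗⇒≋ NP.≤-totalOrder (AllPairs⇒Linked sx) (AllPairs⇒Linked sy) (↭⇒↭ₛ p))

sort : List ℕ → List ℕ
sort = Sort.sort

sort-↭ : ∀ xs → sort xs ↭ xs
sort-↭ = Sort.sort-↭

sort-sorted : ∀ xs → AllPairs _≤_ (sort xs)
sort-sorted xs = Linked⇒AllPairs NP.≤-trans (Sort.sort-↗ xs)

sort-↭-increasing : ∀ {xs S} → xs ↭ S → AllPairs _<_ S → sort xs ≡ S
sort-↭-increasing {xs} {S} p s = sorted-↭⇒≡ (sort-sorted xs) (increasing⇒sorted s) (↭-trans (sort-↭ xs) p)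

sort-increasing : ∀ xs → Unique xs → AllPairs _<_ (sort xs)
sort-increasing xs u = sorted∧unique⇒increasing (sort-sorted xs) (Unique-resp-↭ (↭-sym (sort-↭ xs)) u)

-- Set partitions

_≟L_ : DecidableEquality (List ℕ)
_≟L_ = LP.≡-dec ℕ._≟_

_≟LL_ : DecidableEquality (List (List ℕ))
_≟LL_ = LP.≡-dec _≟L_

head₀ : List ℕ → ℕ
head₀ [] = 0
head₀ (x ∷ _) = x

head₀-∈ : ∀ {b} → NonEmpty b → head₀ b ∈ b
head₀-∈ ne = here refl

IsBlock : List ℕ → Set
IsBlock b = NonEmpty b × AllPairs _<_ b

IsSetPartition : ℕ → List (List ℕ) → Set
IsSetPartition m P = All IsBlock P × AllPairs _<_ (map head₀ P) × (concat P ↭ interval 1 m)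

IsSetPartition⇒unique : ∀ {n P} → IsSetPartition n P → Unique (concat P)
IsSetPartition⇒unique (_ , _ , p) = ↭-interval⇒unique p

head₀-≤ : ∀ {b v} → IsBlock b → v ∈ b → head₀ b ≤ v
head₀-≤ (ne , _) (here refl) = NP.≤-refl
head₀-≤ (ne , ax ∷ _) (there v∈) = NP.<⇒≤ (All.lookup ax v∈)

head₀-≤-concat : ∀ {b B v} → All IsBlock (b ∷ B) → AllPairs _<_ (map head₀ (b ∷ B)) → v ∈ concat (b ∷ B) → head₀ b ≤ v
head₀-≤-concat {b} {B} {v} (ib ∷ bl) (hb ∷ _) v∈ with ∈-++⁻ b v∈
... | inj₁ v∈b = head₀-≤ ib v∈b
... | inj₂ v∈B with ∈-concat⁻′ B v∈B
... | c , v∈c , c∈B = NP.≤-trans (NP.<⇒≤ (All.lookup hb (∈-map⁺ head₀ c∈B))) (head₀-≤ (All.lookup bl c∈B) v∈c)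

increasing⇒head₀ : ∀ {L a} → AllPairs _<_ L → a ∈ L → (∀ {v} → v ∈ L → a ≤ v) → head₀ L ≡ a
increasing⇒head₀ (_ ∷ _) (here refl) _ = refl
increasing⇒head₀ (x< ∷ _) (there a∈) a≤ = ⊥-elim (NP.<-irrefl refl (NP.<-≤-trans (All.lookup x< a∈) (a≤ (here refl))))

head₀-∈-concat : ∀ {B} → All IsBlock B → ∀ {x} → x ∈ map head₀ B → x ∈ concat B
head₀-∈-concat {B} bl xm with ∈-map⁻ head₀ xm
... | b , bm , refl = ∈-concat⁺′ (head₀-∈ (proj₁ (All.lookup bl bm))) bm

map-head₀-map : ∀ (f : ℕ → ℕ) B → All IsBlock B → map head₀ (map (map f) B) ≡ map f (map head₀ B)
map-head₀-map f [] [] = refl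
map-head₀-map f ((x ∷ xs) ∷ B) (_ ∷ bl) = cong (f x ∷_) (map-head₀-map f B bl)

map-head₀-middle : ∀ pre {b c} post → head₀ b ≡ head₀ c → map head₀ (pre ++ b ∷ post) ≡ map head₀ (pre ++ c ∷ post)
map-head₀-middle pre post e = trans (LP.map-++ head₀ pre _) (trans (cong (λ h → map head₀ pre ++ h ∷ map head₀ post) e) (sym (LP.map-++ head₀ pre _)))

extensions : ℕ → List (List ℕ) → List (List (List ℕ))
extensions n π = (π ++ ((suc n ∷ []) ∷ [])) ∷ insertions (suc n) π

∈-insertions⁻ : ∀ m π {P} → P ∈ insertions m π →
  Σ[ pre ∈ List (List ℕ) ] Σ[ b ∈ List ℕ ] Σ[ post ∈ List (List ℕ) ] (π ≡ pre ++ b ∷ post × P ≡ pre ++ (b ++ [ m ]) ∷ post)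
∈-insertions⁻ m (b ∷ bs) (here e) = [] , b , bs , refl , e
∈-insertions⁻ m (b ∷ bs) (there p) with ∈-map⁻ (b ∷_) p
... | q , qm , e with ∈-insertions⁻ m bs qm
... | pre , c , post , e1 , e2 = b ∷ pre , c , post , cong (b ∷_) e1 , trans e (cong (b ∷_) e2)

∈-insertions⁺ : ∀ m pre b post → pre ++ (b ++ [ m ]) ∷ post ∈ insertions m (pre ++ b ∷ post)
∈-insertions⁺ m [] b post = here refl
∈-insertions⁺ m (c ∷ pre) b post = there (∈-map⁺ (c ∷_) (∈-insertions⁺ m pre b post))

∈-SetPartitions-suc⁻ : ∀ n {P} → P ∈ SetPartitions (suc n) → Σ[ π ∈ List (List ℕ) ] (π ∈ SetPartitions n × P ∈ extensions n π)
∈-SetPartitions-suc⁻ n P∈ = find (∈-concatMap⁻ (extensions n) {xs = SetPartitions n} P∈)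

∈-SetPartitions-suc⁺ : ∀ n {P π} → π ∈ SetPartitions n → P ∈ extensions n π → P ∈ SetPartitions (suc n)
∈-SetPartitions-suc⁺ n π∈ P∈ = ∈-concatMap⁺ (extensions n) (lose π∈ P∈)

concat-insert-↭ : ∀ (pre : List (List ℕ)) b post m →
  concat (pre ++ (b ++ [ m ]) ∷ post) ↭ concat (pre ++ b ∷ post) ++ [ m ]
concat-insert-↭ pre b post m = begin
    concat (pre ++ (b ++ [ m ]) ∷ post)
  ≡⟨ concat-mid pre (b ++ [ m ]) post ⟩
    concat pre ++ (b ++ [ m ]) ++ concat post
  ≡⟨ cong (concat pre ++_) (LP.++-assoc b [ m ] (concat post)) ⟩
    concat pre ++ b ++ (m ∷ concat post)
  ↭⟨ PermP.++⁺ˡ (concat pre) (PermP.++⁺ˡ b (PermP.++-comm [ m ] (concat post))) ⟩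
    concat pre ++ b ++ (concat post ++ [ m ])
  ≡⟨ cong (concat pre ++_) (sym (LP.++-assoc b (concat post) [ m ])) ⟩
    concat pre ++ (b ++ concat post) ++ [ m ]
  ≡⟨ sym (LP.++-assoc (concat pre) (b ++ concat post) [ m ]) ⟩
    (concat pre ++ b ++ concat post) ++ [ m ]
  ≡⟨ cong (_++ [ m ]) (sym (concat-mid pre b post)) ⟩
    concat (pre ++ b ∷ post) ++ [ m ] ∎
  where open PermutationReasoning

IsSetPartition-addSingleton : ∀ {n π} → IsSetPartition n π → IsSetPartition (suc n) (π ++ [ [ suc n ] ])
IsSetPartition-addSingleton {n} {π} (bl , hl , pm) =
  AllP.++⁺ bl ((ne , [] ∷ []) ∷ []) ,
  subst (AllPairs _<_) (sym (LP.map-++ head₀ π [ [ suc n ] ]))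
    (APP.++⁺ hl ([] ∷ []) (AllP.map⁺ (All.tabulate (λ b∈ → head₀<1+n b∈ ∷ [])))) ,
  ↭-trans (↭-reflexive (sym (LP.concat-++ π [ [ suc n ] ])))
    (↭-trans (PermP.++⁺ʳ [ suc n ] pm) (↭-reflexive (sym (interval-snoc 1 n))))
  where
  head₀<1+n : ∀ {b} → b ∈ π → head₀ b < suc n
  head₀<1+n b∈ = proj₂ (∈-↭-interval₁ pm (∈-concat⁺′ (head₀-∈ (proj₁ (All.lookup bl b∈))) b∈))

IsSetPartition-addLast : ∀ {n} pre b post → IsSetPartition n (pre ++ b ∷ post) → IsSetPartition (suc n) (pre ++ (b ++ [ suc n ]) ∷ post)
IsSetPartition-addLast {n} pre b post (bl , hl , pm) with All-middle⁻ pre post bl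
... | bl₁ , (ne , ib) , bl₂ =
  All-middle⁺ pre post bl₁ (ne , APP.++⁺ ib ([] ∷ []) (All.tabulate (λ v∈b → proj₂ (∈-↭-interval₁ pm (∈-middle pre post v∈b)) ∷ []))) bl₂ ,
  subst (AllPairs _<_) (map-head₀-middle pre post refl) hl ,
  ↭-trans (concat-insert-↭ pre b post (suc n)) (↭-trans (PermP.++⁺ʳ [ suc n ] pm) (↭-reflexive (sym (interval-snoc 1 n))))

SetPartitions⇒IsSetPartition : ∀ m {P} → P ∈ SetPartitions m → IsSetPartition m P
SetPartitions⇒IsSetPartition zero (here refl) = [] , [] , ↭-refl
SetPartitions⇒IsSetPartition (suc n) P∈ with ∈-SetPartitions-suc⁻ n P∈
... | π , π∈ , here refl = IsSetPartition-addSingleton (SetPartitions⇒IsSetPartition n π∈)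
... | π , π∈ , there P∈ins with ∈-insertions⁻ (suc n) π P∈ins
... | pre , b , post , refl , refl = IsSetPartition-addLast pre b post (SetPartitions⇒IsSetPartition n π∈)

maximum-last : ∀ {m} b → AllPairs _<_ b → m ∈ b → All (_≤ m) b → Σ[ b' ∈ List ℕ ] b ≡ b' ++ [ m ]
maximum-last (x ∷ []) s (here refl) a = [] , refl
maximum-last (x ∷ y ∷ ys) ((xy ∷ _) ∷ s) (here refl) (_ ∷ y≤ ∷ _) = ⊥-elim (NP.<-irrefl refl (NP.<-≤-trans xy y≤))
maximum-last (x ∷ xs) (_ ∷ s) (there m) (_ ∷ a) with maximum-last xs s m a
... | b' , e = x ∷ b' , cong (x ∷_) e

IsSetPartition-dropSingleton : ∀ {n} pre post → IsSetPartition (suc n) (pre ++ [ suc n ] ∷ post) → post ≡ [] × IsSetPartition n pre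
IsSetPartition-dropSingleton {n} pre [] (bl , hl , pm) =
  refl , proj₁ (All-middle⁻ pre [] bl) , AllPairs-++⁻ˡ (map head₀ pre) (subst (AllPairs _<_) (LP.map-++ head₀ pre _) hl) ,
  ∷ʳ-cancel-↭ (↭-trans (↭-reflexive (LP.concat-++ pre [ [ suc n ] ])) (↭-trans pm (↭-reflexive (interval-snoc 1 n))))
IsSetPartition-dropSingleton {n} pre (c ∷ post) (bl , hl , pm)
  with All-middle⁻ pre (c ∷ post) bl | AllPairs-++⁻ʳ (map head₀ pre) (subst (AllPairs _<_) (LP.map-++ head₀ pre _) hl)
... | _ , _ , (ne , _) ∷ _ | (n<c ∷ _) ∷ _ = ⊥-elim (NP.<-irrefl refl (NP.<-≤-trans n<c (NP.≤-pred (proj₂ (∈-↭-interval₁ pm c₀∈)))))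
  where
  c₀∈ : head₀ c ∈ concat (pre ++ [ suc n ] ∷ c ∷ post)
  c₀∈ = ∈-concat⁺′ (head₀-∈ ne) (∈-++⁺ʳ pre (there (here refl)))

IsSetPartition-dropLast : ∀ {n} pre b post → NonEmpty b → IsSetPartition (suc n) (pre ++ (b ++ [ suc n ]) ∷ post) → IsSetPartition n (pre ++ b ∷ post)
IsSetPartition-dropLast {n} pre (x ∷ b) post ne (bl , hl , pm) with All-middle⁻ pre post bl
... | bl₁ , (_ , ib) , bl₂ =
  All-middle⁺ pre post bl₁ (ne , AllPairs-++⁻ˡ (x ∷ b) ib) bl₂ ,
  subst (AllPairs _<_) (map-head₀-middle pre post refl) hl ,
  ∷ʳ-cancel-↭ (↭-trans (↭-sym (concat-insert-↭ pre (x ∷ b) post (suc n))) (↭-trans pm (↭-reflexive (interval-snoc 1 n))))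

-- The largest element n + 1 ends its block; deleting it leaves a set partition of n.
IsSetPartition⇒SetPartitions : ∀ m P → IsSetPartition m P → P ∈ SetPartitions m
IsSetPartition⇒SetPartitions zero [] _ = here refl
IsSetPartition⇒SetPartitions zero (b ∷ P) ((ne , _) ∷ _ , _ , pm) with PermP.∈-resp-↭ pm (here refl)
... | ()
IsSetPartition⇒SetPartitions (suc n) P c@(bl , _ , pm)
  with ∈-concat⇒split P (PermP.∈-resp-↭ (↭-sym pm) (∈-interval⁺ 1 (suc n) (s≤s z≤n) NP.≤-refl))
... | pre , b , post , refl , n∈b
  with maximum-last b (proj₂ (All.lookup bl (∈-++⁺ʳ pre (here refl)))) n∈b
         (All.tabulate (λ v∈b → NP.≤-pred (proj₂ (∈-↭-interval₁ pm (∈-middle pre post v∈b)))))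
... | [] , refl with IsSetPartition-dropSingleton pre post c
... | refl , c′ = ∈-SetPartitions-suc⁺ n (IsSetPartition⇒SetPartitions n pre c′) (here refl)
IsSetPartition⇒SetPartitions (suc n) P c | pre , b , post , refl , _ | x ∷ b′ , refl =
  ∈-SetPartitions-suc⁺ n (IsSetPartition⇒SetPartitions n _ (IsSetPartition-dropLast pre (x ∷ b′) post ne c))
    (there (∈-insertions⁺ (suc n) pre (x ∷ b′) post))

remove : ℕ → List ℕ → List ℕ
remove m [] = []
remove m (x ∷ xs) with x ℕ.≟ m
... | yes _ = remove m xs
... | no _ = x ∷ remove m xs

consNonEmpty : List ℕ → List (List ℕ) → List (List ℕ)
consNonEmpty [] r = r
consNonEmpty (c ∷ cs) r = (c ∷ cs) ∷ r

removeFromBlocks : ℕ → List (List ℕ) → List (List ℕ)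
removeFromBlocks m [] = []
removeFromBlocks m (b ∷ bs) = consNonEmpty (remove m b) (removeFromBlocks m bs)

remove-absent : ∀ m b → All (_< m) b → remove m b ≡ b
remove-absent m [] a = refl
remove-absent m (x ∷ xs) (l ∷ a) with x ℕ.≟ m
... | yes e = ⊥-elim (NP.<-irrefl e l)
... | no _ = cong (x ∷_) (remove-absent m xs a)

remove-∷ʳ : ∀ m b → All (_< m) b → remove m (b ++ [ m ]) ≡ b
remove-∷ʳ m [] a with m ℕ.≟ m
... | yes _ = refl
... | no nq = ⊥-elim (nq refl)
remove-∷ʳ m (x ∷ xs) (l ∷ a) with x ℕ.≟ m
... | yes e = ⊥-elim (NP.<-irrefl e l)
... | no _ = cong (x ∷_) (remove-∷ʳ m xs a)

removeFromBlocks-++ : ∀ m xs ys → removeFromBlocks m (xs ++ ys) ≡ removeFromBlocks m xs ++ removeFromBlocks m ys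
removeFromBlocks-++ m [] ys = refl
removeFromBlocks-++ m (b ∷ xs) ys with remove m b
... | [] = removeFromBlocks-++ m xs ys
... | c ∷ cs = cong ((c ∷ cs) ∷_) (removeFromBlocks-++ m xs ys)

BoundedBlock : ℕ → List ℕ → Set
BoundedBlock m b = NonEmpty b × All (_< m) b

removeFromBlocks-absent : ∀ m π → All (BoundedBlock m) π → removeFromBlocks m π ≡ π
removeFromBlocks-absent m [] a = refl
removeFromBlocks-absent m ((x ∷ xs) ∷ π) ((ne , l) ∷ a) rewrite remove-absent m (x ∷ xs) l = cong ((x ∷ xs) ∷_) (removeFromBlocks-absent m π a)

removeFromBlocks-singleton : ∀ m → removeFromBlocks m [ [ m ] ] ≡ []
removeFromBlocks-singleton m with m ℕ.≟ m
... | yes _ = refl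
... | no nq = ⊥-elim (nq refl)

IsSetPartition⇒bounded : ∀ {n π} → IsSetPartition n π → All (BoundedBlock (suc n)) π
IsSetPartition⇒bounded {n} {π} (bl , hl , pm) = All.tabulate (λ {b} bm → proj₁ (All.lookup bl bm) ,
  All.tabulate (λ {v} vm → proj₂ (∈-↭-interval₁ pm (∈-concat⁺′ vm bm))))

removeFromBlocks-extensions : ∀ n π {P} → IsSetPartition n π → P ∈ extensions n π → removeFromBlocks (suc n) P ≡ π
removeFromBlocks-extensions n π c (here refl) = begin
    removeFromBlocks (suc n) (π ++ [ [ suc n ] ])
  ≡⟨ removeFromBlocks-++ (suc n) π _ ⟩
    removeFromBlocks (suc n) π ++ removeFromBlocks (suc n) [ [ suc n ] ]
  ≡⟨ cong₂ _++_ (removeFromBlocks-absent (suc n) π (IsSetPartition⇒bounded c)) (removeFromBlocks-singleton (suc n)) ⟩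
    π ++ []
  ≡⟨ LP.++-identityʳ π ⟩
    π ∎
  where open ≡-Reasoning
removeFromBlocks-extensions n π c (there im) with ∈-insertions⁻ (suc n) π im
... | pre , b , post , refl , refl with All-middle⁻ pre post (IsSetPartition⇒bounded c)
... | a1 , (ne , lb) , a2 = begin
    removeFromBlocks (suc n) (pre ++ (b ++ [ suc n ]) ∷ post)
  ≡⟨ removeFromBlocks-++ (suc n) pre _ ⟩
    removeFromBlocks (suc n) pre ++ consNonEmpty (remove (suc n) (b ++ [ suc n ])) (removeFromBlocks (suc n) post)
  ≡⟨ cong₂ _++_ (removeFromBlocks-absent (suc n) pre a1) (cong₂ consNonEmpty (remove-∷ʳ (suc n) b lb) (removeFromBlocks-absent (suc n) post a2)) ⟩
    pre ++ consNonEmpty b post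
  ≡⟨ cong (pre ++_) (cons-nonEmpty b ne) ⟩
    pre ++ b ∷ post ∎
  where
  open ≡-Reasoning
  cons-nonEmpty : ∀ b → NonEmpty b → consNonEmpty b post ≡ b ∷ post
  cons-nonEmpty (x ∷ xs) ne = refl

length-insertions : ∀ m π {P} → P ∈ insertions m π → length P ≡ length π
length-insertions m π im with ∈-insertions⁻ m π im
... | pre , b , post , refl , refl = trans (LP.length-++ pre) (sym (LP.length-++ pre))

unique-insertions : ∀ m π → Unique (insertions m π)
unique-insertions m [] = []
unique-insertions m (b ∷ bs) =
  All.tabulate (λ q∈ e → ∷ʳ-length≢ b refl (first-block-≡ q∈ e)) ∷ UP.map⁺ (λ e → proj₂ (LP.∷-injective e)) (unique-insertions m bs)
  where
  first-block-≡ : ∀ {q} → q ∈ map (b ∷_) (insertions m bs) → (b ++ [ m ]) ∷ bs ≡ q → b ++ [ m ] ≡ b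
  first-block-≡ q∈ e with ∈-map⁻ (b ∷_) q∈
  ... | _ , _ , refl = proj₁ (LP.∷-injective e)

unique-extensions : ∀ n π → Unique (extensions n π)
unique-extensions n π =
  All.tabulate (λ P∈ → ∷ʳ-length≢ π (length-insertions (suc n) π P∈))
  ∷ unique-insertions (suc n) π

unique-SetPartitions : ∀ m → Unique (SetPartitions m)
unique-SetPartitions zero = [] ∷ []
unique-SetPartitions (suc n) = UP.concat⁺ (AllP.map⁺ (All.tabulate (λ {π} _ → unique-extensions n π)))
  (APP.map⁺ (AllPairs-map-∈ (SetPartitions n) (unique-SetPartitions n) disj))
  where
  disj : ∀ {π π'} → π ∈ SetPartitions n → π' ∈ SetPartitions n → π ≢ π' → Disjoint (extensions n π) (extensions n π')
  disj {π} {π'} π∈ π′∈ π≢π′ (v∈ , v∈′) = π≢π′ (trans (sym (removeFromBlocks-extensions n π (SetPartitions⇒IsSetPartition n π∈) v∈))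
                                                      (removeFromBlocks-extensions n π' (SetPartitions⇒IsSetPartition n π′∈) v∈′))

SetPartitions-nonEmpty : ∀ m → NonEmpty (SetPartitions m)
SetPartitions-nonEmpty zero = ne
SetPartitions-nonEmpty (suc n) = concatMap-nonEmpty (SetPartitions n) (SetPartitions-nonEmpty n)
  where
  concatMap-nonEmpty : ∀ L → NonEmpty L → NonEmpty (concatMap (extensions n) L)
  concatMap-nonEmpty (π ∷ L) ne = ne

unique-heads : ∀ L → All IsBlock L → Unique (concat L) → Unique (map head₀ L)
unique-heads [] _ _ = []
unique-heads (b ∷ L) ((nb , _) ∷ bl) u =
  All.tabulate (λ {w} wm e → Unique-++⇒disjoint b u (head₀-∈ nb) (subst (_∈ concat L) (sym e) (head₀-∈-concat bl wm)))
  ∷ unique-heads L bl (AllPairs-++⁻ʳ b u)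

blockWithHead : List (List ℕ) → ℕ → List ℕ
blockWithHead [] v = []
blockWithHead (b ∷ L) v with head₀ b ℕ.≟ v
... | yes _ = b
... | no _ = blockWithHead L v

blockWithHead-head₀ : ∀ L → Unique (map head₀ L) → ∀ {b} → b ∈ L → blockWithHead L (head₀ b) ≡ b
blockWithHead-head₀ (c ∷ L) u (here refl) with head₀ c ℕ.≟ head₀ c
... | yes _ = refl
... | no nq = ⊥-elim (nq refl)
blockWithHead-head₀ (c ∷ L) (a ∷ u) {b} (there bm) with head₀ c ℕ.≟ head₀ b
... | yes e = ⊥-elim (All.lookup a (∈-map⁺ head₀ bm) e)
... | no _ = blockWithHead-head₀ L u bm

head₀-blockWithHead : ∀ L {v} → v ∈ map head₀ L → head₀ (blockWithHead L v) ≡ v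
head₀-blockWithHead (c ∷ L) {v} vm with head₀ c ℕ.≟ v
... | yes e = e
head₀-blockWithHead (c ∷ L) {v} (here e) | no nq = ⊥-elim (nq (sym e))
head₀-blockWithHead (c ∷ L) {v} (there vm) | no nq = head₀-blockWithHead L vm

blockWithHead-↭ : ∀ {L L'} → L ↭ L' → Unique (map head₀ L') → ∀ {v} → v ∈ map head₀ L → blockWithHead L v ≡ blockWithHead L' v
blockWithHead-↭ {L} {L'} p u {v} vm with ∈-map⁻ head₀ vm
... | b , bm , refl = trans (bwh-hd' bm) (sym (blockWithHead-head₀ L' u (PermP.∈-resp-↭ p bm)))
  where
  bwh-hd' : ∀ {b} → b ∈ L → blockWithHead L (head₀ b) ≡ b
  bwh-hd' bm = blockWithHead-head₀ L (Unique-resp-↭ (PermP.map⁺ head₀ (↭-sym p)) u) bm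

heads-increasing-↭⇒≡ : ∀ {π π'} → AllPairs _<_ (map head₀ π) → AllPairs _<_ (map head₀ π') → π ↭ π' → π ≡ π'
heads-increasing-↭⇒≡ {π} {π'} h h' p = begin
    π
  ≡⟨ sym (trans (sym (LP.map-∘ π)) (map-id-∈ π (λ bm → blockWithHead-head₀ π (increasing⇒unique h) bm))) ⟩
    map (blockWithHead π) (map head₀ π)
  ≡⟨ map-cong-∈ (map head₀ π) (λ vm → blockWithHead-↭ p (increasing⇒unique h') vm) ⟩
    map (blockWithHead π') (map head₀ π)
  ≡⟨ cong (map (blockWithHead π')) (sorted-↭⇒≡ (increasing⇒sorted h) (increasing⇒sorted h') (PermP.map⁺ head₀ p)) ⟩
    map (blockWithHead π') (map head₀ π')
  ≡⟨ trans (sym (LP.map-∘ π')) (map-id-∈ π' (λ bm → blockWithHead-head₀ π' (increasing⇒unique h') bm)) ⟩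
    π' ∎
  where open ≡-Reasoning

-- Colored blocks as set partitions

nth : List ℕ → ℕ → ℕ
nth S = lookup₁ 0 S

nth-monotone : ∀ S → AllPairs _<_ S → ∀ {i j} → i ∈ interval 1 (length S) → j ∈ interval 1 (length S) → i < j → nth S i < nth S j
nth-monotone [] s ()
nth-monotone (a ∷ as) s {suc i} {suc j} im jm (s≤s l) = lookupClamped-monotone ℕ._≟_ (λ x → x) a as s i j l (proj₂ (∈-interval₁-bounds jm))
nth-monotone (a ∷ as) s {zero} im jm l with ∈-interval₁-bounds im
... | () , _

setPartitionAt : ℕ → ℕ → List (List ℕ)
setPartitionAt m i = lookup₁ [] (SetPartitions m) i

-- The colored block (S , i), 1 ≤ i ≤ bell |S|, becomes the i-th set partition of {1, …, |S|}
-- carried over to S by the increasing bijection; collapseBlock reads (S , i) back off.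
expandBlock : List ℕ × ℕ → List (List ℕ)
expandBlock (S , i) = map (map (nth S)) (setPartitionAt (length S) i)

standardizeBlocks : List ℕ → List (List ℕ) → List (List ℕ)
standardizeBlocks S B = map (map (position ℕ._≟_ S)) B

collapseBlock : List (List ℕ) → List ℕ × ℕ
collapseBlock B = sort (concat B) , position _≟LL_ (SetPartitions (length (sort (concat B)))) (standardizeBlocks (sort (concat B)) B)

IsColoredBlock : List ℕ × ℕ → Set
IsColoredBlock (S , i) = AllPairs _<_ S × 1 ≤ i × i ≤ bell (length S)

setPartitionAt-∈ : ∀ m i → setPartitionAt m i ∈ SetPartitions m
setPartitionAt-∈ m i with SetPartitions m | SetPartitions-nonEmpty m
... | Q ∷ Qs | ne = lookupClamped-∈ Q Qs (pred i)

setPartitionAt-isSetPartition : ∀ m i → IsSetPartition m (setPartitionAt m i)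
setPartitionAt-isSetPartition m i = SetPartitions⇒IsSetPartition m (setPartitionAt-∈ m i)

concat-expandBlock : ∀ S i → concat (expandBlock (S , i)) ↭ S
concat-expandBlock S i = begin
    concat (map (map (nth S)) (setPartitionAt (length S) i))
  ≡⟨ LP.concat-map (setPartitionAt (length S) i) ⟩
    map (nth S) (concat (setPartitionAt (length S) i))
  ↭⟨ PermP.map⁺ (nth S) (proj₂ (proj₂ (setPartitionAt-isSetPartition (length S) i))) ⟩
    map (nth S) (interval 1 (length S))
  ≡⟨ map-lookup₁-interval 0 S ⟩
    S ∎
  where open PermutationReasoning

position-nth : ∀ S → Unique S → ∀ {k} → k ∈ interval 1 (length S) → position ℕ._≟_ S (nth S k) ≡ k
position-nth [] u ()
position-nth (x ∷ xs) u {suc k} km = cong suc (position₀-lookupClamped ℕ._≟_ x xs k u (NP.≤-pred (proj₂ (∈-interval⁻ 1 (suc (length xs)) km))))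
position-nth (x ∷ xs) u {zero} km with ∈-interval⁻ 1 (suc (length xs)) km
... | () , _

position₀<length : ∀ {A : Set} (eq : DecidableEquality A) L {a} → a ∈ L → position₀ eq L a < length L
position₀<length eq (x ∷ xs) {a} (here refl) rewrite position₀-here eq x xs = s≤s z≤n
position₀<length eq (x ∷ xs) {a} (there m) with eq x a
... | yes _ = s≤s z≤n
... | no _ = s≤s (position₀<length eq xs m)

position-setPartitionAt : ∀ m i → 1 ≤ i → i ≤ bell m → position _≟LL_ (SetPartitions m) (setPartitionAt m i) ≡ i
position-setPartitionAt m (suc i') _ i≤b = position-lookup₁ (SetPartitions m) (unique-SetPartitions m) i≤b
  where
  position-lookup₁ : ∀ L → Unique L → suc i' ≤ length L → position _≟LL_ L (lookup₁ [] L (suc i')) ≡ suc i'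
  position-lookup₁ (Q ∷ Qs) u l = cong suc (position₀-lookupClamped _≟LL_ Q Qs i' u l)

collapse-expand : ∀ S i → IsColoredBlock (S , i) → collapseBlock (expandBlock (S , i)) ≡ (S , i)
collapse-expand S i (sS , 1≤i , i≤b) = cong₂ _,_ sort-concat (begin
    position _≟LL_ (SetPartitions (length (sort (concat B)))) (standardizeBlocks (sort (concat B)) B)
  ≡⟨ cong (λ T → position _≟LL_ (SetPartitions (length T)) (standardizeBlocks T B)) sort-concat ⟩
    position _≟LL_ (SetPartitions (length S)) (standardizeBlocks S B)
  ≡⟨ cong (position _≟LL_ (SetPartitions (length S))) standardize-expand ⟩
    position _≟LL_ (SetPartitions (length S)) P
  ≡⟨ position-setPartitionAt (length S) i 1≤i i≤b ⟩
    i ∎)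
  where
  open ≡-Reasoning
  B P : List (List ℕ)
  B = expandBlock (S , i)
  P = setPartitionAt (length S) i
  sort-concat : sort (concat B) ≡ S
  sort-concat = sort-↭-increasing (concat-expandBlock S i) sS
  standardize-expand : standardizeBlocks S B ≡ P
  standardize-expand = trans (sym (LP.map-∘ P)) (trans (LP.map-cong (λ b → sym (LP.map-∘ b)) P)
    (map-map-id-∈ P (λ v∈ → position-nth S (increasing⇒unique sS) (PermP.∈-resp-↭ (proj₂ (proj₂ (setPartitionAt-isSetPartition (length S) i))) v∈))))

IsBlockFamily : List (List ℕ) → Set
IsBlockFamily B = All IsBlock B × AllPairs _<_ (map head₀ B) × Unique (concat B)

MonotoneOn : (ℕ → ℕ) → List ℕ → Set
MonotoneOn f xs = ∀ {v w} → v ∈ xs → w ∈ xs → v < w → f v < f w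

blocks-map-monotone : ∀ {f} B → MonotoneOn f (concat B) → All IsBlock B → AllPairs _<_ (map head₀ B) →
                      All IsBlock (map (map f) B) × AllPairs _<_ (map head₀ (map (map f) B))
blocks-map-monotone {f} B mono bl hl =
  AllP.map⁺ (All.tabulate (λ b∈ → block b∈ (All.lookup bl b∈))) ,
  subst (AllPairs _<_) (sym (map-head₀-map f B bl))
    (APP.map⁺ (AllPairs-map-∈ (map head₀ B) hl (λ v∈ w∈ → mono (head₀-∈-concat bl v∈) (head₀-∈-concat bl w∈))))
  where
  block : ∀ {b} → b ∈ B → IsBlock b → IsBlock (map f b)
  block {x ∷ xs} b∈ (ne , ib) = ne , APP.map⁺ (AllPairs-map-∈ (x ∷ xs) ib (λ v∈ w∈ → mono (∈-concat⁺′ v∈ b∈) (∈-concat⁺′ w∈ b∈)))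

module CollapseBlock (B : List (List ℕ)) (family : IsBlockFamily B) where

  S : List ℕ
  S = sort (concat B)

  S-increasing : AllPairs _<_ S
  S-increasing = sort-increasing (concat B) (proj₂ (proj₂ family))

  private
    ∈S : ∀ {v} → v ∈ concat B → v ∈ S
    ∈S = PermP.∈-resp-↭ (↭-sym (sort-↭ (concat B)))

    indexIn : ℕ → ℕ
    indexIn = position ℕ._≟_ S

    concat-standardize : concat (standardizeBlocks S B) ↭ interval 1 (length S)
    concat-standardize = begin
        concat (map (map indexIn) B)    ≡⟨ LP.concat-map B ⟩
        map indexIn (concat B)          ↭⟨ PermP.map⁺ indexIn (↭-sym (sort-↭ (concat B))) ⟩
        map indexIn S                   ≡⟨ LP.map-∘ S ⟩
        map suc (map (position₀ ℕ._≟_ S) S)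
          ≡⟨ cong (map suc) (map-position₀-self ℕ._≟_ S (increasing⇒unique S-increasing)) ⟩
        map suc (interval 0 (length S))  ≡⟨ interval-suc 0 (length S) ⟨
        interval 1 (length S)        ∎
      where open PermutationReasoning

    standardize-isSetPartition : IsSetPartition (length S) (standardizeBlocks S B)
    standardize-isSetPartition with blocks-map-monotone B
      (λ v∈ w∈ v<w → s≤s (position₀-monotone ℕ._≟_ (λ x → x) S S-increasing (∈S v∈) (∈S w∈) v<w))
      (proj₁ family) (proj₁ (proj₂ family))
    ... | bl , hl = bl , hl , concat-standardize

    standardize-∈ : standardizeBlocks S B ∈ SetPartitions (length S)
    standardize-∈ = IsSetPartition⇒SetPartitions (length S) (standardizeBlocks S B) standardize-isSetPartition

  expand-collapse : expandBlock (collapseBlock B) ≡ B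
  expand-collapse = begin
      map (map (nth S)) (setPartitionAt (length S) (position _≟LL_ (SetPartitions (length S)) (standardizeBlocks S B)))
    ≡⟨ cong (map (map (nth S))) (lookup₁-position _≟LL_ [] (SetPartitions (length S)) (standardizeBlocks S B) standardize-∈) ⟩
      map (map (nth S)) (map (map indexIn) B)
    ≡⟨ trans (sym (LP.map-∘ B)) (LP.map-cong (λ b → sym (LP.map-∘ b)) B) ⟩
      map (map (λ v → nth S (indexIn v))) B
    ≡⟨ map-map-id-∈ B (λ {v} v∈ → lookup₁-position ℕ._≟_ 0 S v (∈S v∈)) ⟩
      B ∎
    where open ≡-Reasoning

  collapse-colored : IsColoredBlock (collapseBlock B)
  collapse-colored = S-increasing , s≤s z≤n , position₀<length _≟LL_ (SetPartitions (length S)) standardize-∈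

  head₀-sort : ∀ {b B'} → B ≡ b ∷ B' → head₀ S ≡ head₀ b
  head₀-sort refl = increasing⇒head₀ S-increasing (∈S (∈-++⁺ˡ (head₀-∈ (proj₁ (All.lookup (proj₁ family) (here refl))))))
                      (λ v∈S → head₀-≤-concat (proj₁ family) (proj₁ (proj₂ family)) (PermP.∈-resp-↭ (sort-↭ (concat B)) v∈S))

headBlock : List (List ℕ) → List ℕ
headBlock [] = []
headBlock (b ∷ _) = b

module ExpandBlock (S : List ℕ) (i : ℕ) (S-increasing : AllPairs _<_ S) where

  private
    P B : List (List ℕ)
    P = setPartitionAt (length S) i
    B = expandBlock (S , i)

    P-isSetPartition : IsSetPartition (length S) P
    P-isSetPartition = setPartitionAt-isSetPartition (length S) i

    ∈interval : ∀ {v} → v ∈ concat P → v ∈ interval 1 (length S)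
    ∈interval = PermP.∈-resp-↭ (proj₂ (proj₂ P-isSetPartition))

    blocks : All IsBlock B × AllPairs _<_ (map head₀ B)
    blocks = blocks-map-monotone P (λ v∈ w∈ → nth-monotone S S-increasing (∈interval v∈) (∈interval w∈))
               (proj₁ P-isSetPartition) (proj₁ (proj₂ P-isSetPartition))

    family : IsBlockFamily B
    family = proj₁ blocks , proj₂ blocks , Unique-resp-↭ (↭-sym (concat-expandBlock S i)) (increasing⇒unique S-increasing)

  isBlock : All IsBlock B
  isBlock = proj₁ blocks

  heads-increasing : AllPairs _<_ (map head₀ B)
  heads-increasing = proj₂ blocks

  nonEmpty : NonEmpty S → NonEmpty B
  nonEmpty nS = concat-nonEmpty B (PermP.∈-resp-↭ (↭-sym (concat-expandBlock S i)) (head₀-∈ {b = S} nS))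
    where
    concat-nonEmpty : ∀ C {v} → v ∈ concat C → NonEmpty C
    concat-nonEmpty (_ ∷ _) _ = ne

  head₀-headBlock : NonEmpty S → head₀ (headBlock B) ≡ head₀ S
  head₀-headBlock nS = head₀-first B refl (nonEmpty nS)
    where
    head₀-first : ∀ C → B ≡ C → NonEmpty C → head₀ (headBlock C) ≡ head₀ S
    head₀-first (b ∷ C) e ne = trans (sym (CollapseBlock.head₀-sort B family e)) (cong head₀ (sort-↭-increasing (concat-expandBlock S i) S-increasing))

-- Colored set partitions and set partitions of level 2

blockAt-lookup₁ : ∀ π j → 1 ≤ j → j ≤ length π → blockAt π j ≡ lookup₁ [] π j
blockAt-lookup₁ (b ∷ []) (suc zero) _ _ = refl
blockAt-lookup₁ (b ∷ c ∷ bs) (suc zero) _ _ = refl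
blockAt-lookup₁ (b ∷ []) (suc (suc j)) _ (s≤s ())
blockAt-lookup₁ (b ∷ c ∷ bs) (suc (suc j)) _ (s≤s l) = blockAt-lookup₁ (c ∷ bs) (suc j) (s≤s z≤n) l

map-blockAt-interval : ∀ π → map (blockAt π) (interval 1 (length π)) ≡ π
map-blockAt-interval π = trans
  (map-cong-∈ (interval 1 (length π)) (λ j∈ → blockAt-lookup₁ π _ (proj₁ (∈-interval₁-bounds j∈)) (proj₂ (∈-interval₁-bounds j∈))))
  (map-lookup₁-interval [] π)

blockAt-∈ : ∀ π {j} → j ∈ interval 1 (length π) → blockAt π j ∈ π
blockAt-∈ π {j} jm with ∈-interval₁-bounds jm
blockAt-∈ (b ∷ bs) {suc j} jm | l , u rewrite blockAt-lookup₁ (b ∷ bs) (suc j) l u = lookupClamped-∈ b bs j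

blockAt-monotone : ∀ π → AllPairs (λ a b → head₀ a < head₀ b) π → ∀ {i j} → i ∈ interval 1 (length π) → j ∈ interval 1 (length π) →
                   i < j → head₀ (blockAt π i) < head₀ (blockAt π j)
blockAt-monotone π s {i} {j} im jm l with ∈-interval₁-bounds im | ∈-interval₁-bounds jm
blockAt-monotone (b ∷ bs) s {suc i} {suc j} im jm (s≤s l) | li , ui | lj , uj
  rewrite blockAt-lookup₁ (b ∷ bs) (suc i) li ui | blockAt-lookup₁ (b ∷ bs) (suc j) lj uj = lookupClamped-monotone _≟L_ head₀ b bs s i j l uj

position-blockAt : ∀ π → Unique π → ∀ {i} → i ∈ interval 1 (length π) → position _≟L_ π (blockAt π i) ≡ i
position-blockAt π uπ {i} im with ∈-interval₁-bounds im
position-blockAt (b ∷ bs) uπ {suc i} im | l , u =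
  trans (cong (position _≟L_ (b ∷ bs)) (blockAt-lookup₁ (b ∷ bs) (suc i) l u)) (cong suc (position₀-lookupClamped _≟L_ b bs i uπ u))

ValidColor : List ℕ × ℕ → Set
ValidColor (b , i) = 1 ≤ i × i ≤ bell (length b)

∈-colorings⁻ : ∀ π {x} → x ∈ colorings bell π → map proj₁ x ≡ π × All ValidColor x
∈-colorings⁻ [] (here refl) = refl , []
∈-colorings⁻ (b ∷ bs) xm with find (∈-concatMap⁻ (λ i → map ((b , suc i) ∷_) (colorings bell bs)) {xs = upTo (bell (length b))} xm)
... | i , im , xm' with ∈-map⁻ ((b , suc i) ∷_) xm'
... | x' , x'm , refl with ∈-colorings⁻ bs x'm
... | e , a = cong (b ∷_) e , (s≤s z≤n , ∈-upTo⁻ im) ∷ a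

∈-colorings⁺ : ∀ π x → map proj₁ x ≡ π → All ValidColor x → x ∈ colorings bell π
∈-colorings⁺ [] [] e a = here refl
∈-colorings⁺ (b ∷ bs) ((.b , suc i) ∷ x) refl ((_ , l) ∷ a) =
  ∈-concatMap⁺ (λ i → map ((b , suc i) ∷_) (colorings bell bs))
    (lose (∈-upTo⁺ {n = bell (length b)} l) (∈-map⁺ ((b , suc i) ∷_) (∈-colorings⁺ bs x refl a)))
∈-colorings⁺ (b ∷ bs) ((.b , zero) ∷ x) refl ((() , _) ∷ a)

IsColoredSetPartition : ℕ → CRaw → Set
IsColoredSetPartition n x = IsSetPartition n (map proj₁ x) × All ValidColor x

coloredSetPartitions : ℕ → List CRaw
coloredSetPartitions n = concatMap (colorings bell) (SetPartitions n)

∈-coloredSetPartitions⁻ : ∀ n {x} → x ∈ coloredSetPartitions n → IsColoredSetPartition n x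
∈-coloredSetPartitions⁻ n xm with find (∈-concatMap⁻ (colorings bell) {xs = SetPartitions n} xm)
... | π , πm , xm' with ∈-colorings⁻ π xm'
... | e , a = subst (IsSetPartition n) (sym e) (SetPartitions⇒IsSetPartition n πm) , a

∈-coloredSetPartitions⁺ : ∀ n x → IsColoredSetPartition n x → x ∈ coloredSetPartitions n
∈-coloredSetPartitions⁺ n x (c , a) =
  ∈-concatMap⁺ (colorings bell) (lose (IsSetPartition⇒SetPartitions n (map proj₁ x) c) (∈-colorings⁺ (map proj₁ x) x refl a))

∈-level2⁻ : ∀ n {y} → y ∈ level2 n →
            Σ[ π ∈ List (List ℕ) ] Σ[ σ ∈ List (List ℕ) ] (π ∈ SetPartitions n × σ ∈ SetPartitions (length π) × y ≡ map (map (blockAt π)) σ)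
∈-level2⁻ n ym with find (∈-concatMap⁻ (λ π → map (map (map (blockAt π))) (SetPartitions (length π))) {xs = SetPartitions n} ym)
... | π , πm , ym' with ∈-map⁻ (map (map (blockAt π))) ym'
... | σ , σm , e = π , σ , πm , σm , e

∈-level2⁺ : ∀ n π σ → π ∈ SetPartitions n → σ ∈ SetPartitions (length π) → map (map (blockAt π)) σ ∈ level2 n
∈-level2⁺ n π σ πm σm = ∈-concatMap⁺ (λ π → map (map (map (blockAt π))) (SetPartitions (length π))) (lose πm (∈-map⁺ (map (map (blockAt π))) σm))

unique-colorings : ∀ π → Unique (colorings bell π)
unique-colorings [] = [] ∷ []
unique-colorings (b ∷ bs) = UP.concat⁺ (AllP.map⁺ (All.tabulate (λ {i} _ → UP.map⁺ (λ e → proj₂ (LP.∷-injective e)) (unique-colorings bs))))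
  (APP.map⁺ (AP.map {R = _≢_} (λ {i} {j} nq {v} (vi , vj) → nq (same-color i j vi vj)) (UP.upTo⁺ (bell (length b)))))
  where
  same-color : ∀ i j {v} → v ∈ map ((b , suc i) ∷_) (colorings bell bs) → v ∈ map ((b , suc j) ∷_) (colorings bell bs) → i ≡ j
  same-color i j vi vj with ∈-map⁻ _ vi | ∈-map⁻ _ vj
  ... | _ , _ , refl | _ , _ , e = cong pred (cong proj₂ (proj₁ (LP.∷-injective e)))

unique-coloredSetPartitions : ∀ n → Unique (coloredSetPartitions n)
unique-coloredSetPartitions n = UP.concat⁺ (AllP.map⁺ (All.tabulate (λ {π} _ → unique-colorings π)))
  (APP.map⁺ (AP.map {R = _≢_} (λ {π} {π'} π≢π′ {_} (v∈ , v∈′) → π≢π′ (trans (sym (proj₁ (∈-colorings⁻ π v∈))) (proj₁ (∈-colorings⁻ π' v∈′))))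
                              (unique-SetPartitions n)))

AllColored : CRaw → Set
AllColored = All IsColoredBlock

countBelow : ℕ → List ℕ → ℕ
countBelow v L = length (filter (_<? v) L)

countBelow-accept : ∀ {v x} xs → x < v → countBelow v (x ∷ xs) ≡ suc (countBelow v xs)
countBelow-accept {v} xs l = cong length (LP.filter-accept (_<? v) l)

countBelow-reject : ∀ {v x} xs → ¬ x < v → countBelow v (x ∷ xs) ≡ countBelow v xs
countBelow-reject {v} xs l = cong length (LP.filter-reject (_<? v) l)

countBelow-mono : ∀ {u v} L → u ≤ v → countBelow u L ≤ countBelow v L
countBelow-mono [] l = z≤n
countBelow-mono {u} {v} (x ∷ xs) l with x <? u | x <? v
... | yes a | yes b rewrite countBelow-accept {u} xs a | countBelow-accept {v} xs b = s≤s (countBelow-mono xs l)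
... | yes a | no b = ⊥-elim (b (NP.<-≤-trans a l))
... | no a | yes b rewrite countBelow-reject {u} xs a | countBelow-accept {v} xs b = NP.m≤n⇒m≤1+n (countBelow-mono xs l)
... | no a | no b rewrite countBelow-reject {u} xs a | countBelow-reject {v} xs b = countBelow-mono xs l

countBelow-strict : ∀ {u v} L → u ∈ L → u < v → suc (countBelow u L) ≤ countBelow v L
countBelow-strict {u} {v} (x ∷ xs) (here refl) l with x <? u | x <? v
... | yes a | _ = ⊥-elim (NP.<-irrefl refl a)
... | no a | yes b rewrite countBelow-reject {u} xs a | countBelow-accept {v} xs b = s≤s (countBelow-mono xs (NP.<⇒≤ l))
... | no _ | no b = ⊥-elim (b l)
countBelow-strict {u} {v} (x ∷ xs) (there m) l with x <? u | x <? v
... | yes a | yes b rewrite countBelow-accept {u} xs a | countBelow-accept {v} xs b = s≤s (countBelow-strict xs m l)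
... | yes a | no b = ⊥-elim (b (NP.<-trans a l))
... | no a | yes b rewrite countBelow-reject {u} xs a | countBelow-accept {v} xs b = NP.m≤n⇒m≤1+n (countBelow-strict xs m l)
... | no a | no b rewrite countBelow-reject {u} xs a | countBelow-reject {v} xs b = countBelow-strict xs m l

rank-strict : ∀ {L u v} → u ∈ L → u < v → rank L u < rank L v
rank-strict {L} m l = s≤s (countBelow-strict L m l)

colored-cstd : ∀ A → AllColored A → AllColored (cstd A)
colored-cstd A g = AllP.map⁺ (All.tabulate (λ {s} sm → colored-block s sm (All.lookup g sm)))
  where
  colored-block : ∀ s → s ∈ A → IsColoredBlock s → IsColoredBlock (map (rank (cints A)) (proj₁ s) , proj₂ s)
  colored-block (S , i) sm (sS , l1 , l2) = APP.map⁺ (AllPairs-map-∈ S sS (λ am _ l → rank-strict (∈-concat⁺′ am (∈-map⁺ proj₁ sm)) l)) ,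
    l1 , subst (λ t → i ≤ bell t) (sym (LP.length-map _ S)) l2

colored-cshift : ∀ n x → AllColored x → AllColored (cshift n x)
colored-cshift n x g = AllP.map⁺ (All.map (λ {s} (sS , l1 , l2) →
  APP.map⁺ (AP.map (λ l → NP.+-monoʳ-< n l) sS) , l1 , subst (λ t → proj₂ s ≤ bell t) (sym (LP.length-map _ (proj₁ s))) l2) g)

IsColoredSetPartition⇒AllColored : ∀ n x → IsColoredSetPartition n x → AllColored x
IsColoredSetPartition⇒AllColored n x (c , cols) = All.tabulate (λ {s} sm → proj₂ (All.lookup (proj₁ c) (∈-map⁺ proj₁ sm)) , All.lookup cols sm)

∈-coloredSetPartitions⇒AllColored : ∀ n {x} → x ∈ coloredSetPartitions n → AllColored x
∈-coloredSetPartitions⇒AllColored n {x} xm = IsColoredSetPartition⇒AllColored n x (∈-coloredSetPartitions⁻ n xm)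

-- The bijection

toLevel2 : CRaw → LRaw
toLevel2 = map expandBlock

fromLevel2 : LRaw → CRaw
fromLevel2 = map collapseBlock

module FromLevel2 (n : ℕ) {π σ : List (List ℕ)} (π∈ : π ∈ SetPartitions n) (σ∈ : σ ∈ SetPartitions (length π)) where

  y : LRaw
  y = map (map (blockAt π)) σ

  private
    πₚ : IsSetPartition n π
    πₚ = SetPartitions⇒IsSetPartition n π∈

    σₚ : IsSetPartition (length π) σ
    σₚ = SetPartitions⇒IsSetPartition (length π) σ∈

    π-heads : AllPairs (λ a b → head₀ a < head₀ b) π
    π-heads = APP.map⁻ (proj₁ (proj₂ πₚ))

    index∈ : ∀ {j} → j ∈ concat σ → j ∈ interval 1 (length π)
    index∈ = PermP.∈-resp-↭ (proj₂ (proj₂ σₚ))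

  concat-y : concat y ↭ π
  concat-y = ↭-trans (↭-reflexive (LP.concat-map σ))
               (↭-trans (PermP.map⁺ (blockAt π) (proj₂ (proj₂ σₚ))) (↭-reflexive (map-blockAt-interval π)))

  private
    concat-concat-y : concat (map concat y) ↭ concat π
    concat-concat-y = ↭-trans (↭-reflexive (LP.concat-concat y)) (concat-↭ concat-y)

    block-family : ∀ {B} → B ∈ y → IsBlockFamily B
    block-family {B} B∈ with ∈-map⁻ (map (blockAt π)) B∈
    ... | c , c∈ , refl =
      AllP.map⁺ (All.tabulate (λ j∈ → All.lookup (proj₁ πₚ) (blockAt-∈ π (index∈ (∈-concat⁺′ j∈ c∈))))) ,
      subst (AllPairs _<_) (LP.map-∘ c) (APP.map⁺ (AllPairs-map-∈ c (proj₂ (All.lookup (proj₁ σₚ) c∈))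
        (λ i∈ j∈ → blockAt-monotone π π-heads (index∈ (∈-concat⁺′ i∈ c∈)) (index∈ (∈-concat⁺′ j∈ c∈))))) ,
      All.lookup (AllP.map⁻ (Unique-concat⁻ (map concat y) (Unique-resp-↭ (↭-sym concat-concat-y) (IsSetPartition⇒unique πₚ)))) B∈

  to-from : toLevel2 (fromLevel2 y) ≡ y
  to-from = trans (sym (LP.map-∘ y)) (map-id-∈ y (λ B∈ → CollapseBlock.expand-collapse _ (block-family B∈)))

  private
    sortedBlock : List (List ℕ) → List ℕ
    sortedBlock B = sort (concat B)

    sortedBlock-nonEmpty : ∀ {B} → B ∈ y → NonEmpty (sortedBlock B)
    sortedBlock-nonEmpty B∈ with ∈-map⁻ (map (blockAt π)) B∈
    ... | [] , c∈ , refl with proj₁ (All.lookup (proj₁ σₚ) c∈)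
    ... | ()
    sortedBlock-nonEmpty B∈ | j ∷ c , c∈ , refl =
      ∈⇒NonEmpty (PermP.∈-resp-↭ (↭-sym (sort-↭ (concat (map (blockAt π) (j ∷ c)))))
        (∈-++⁺ˡ (head₀-∈ (proj₁ (All.lookup (proj₁ πₚ) (blockAt-∈ π (index∈ (∈-concat⁺′ (here refl) c∈))))))))

    head₀-sortedBlock : ∀ {c} → c ∈ σ → head₀ (sortedBlock (map (blockAt π) c)) ≡ head₀ (blockAt π (head₀ c))
    head₀-sortedBlock {[]} c∈ with proj₁ (All.lookup (proj₁ σₚ) c∈)
    ... | ()
    head₀-sortedBlock {j ∷ c} c∈ = CollapseBlock.head₀-sort (map (blockAt π) (j ∷ c)) (block-family (∈-map⁺ (map (blockAt π)) c∈)) refl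

    sortedBlocks-heads : AllPairs _<_ (map head₀ (map sortedBlock y))
    sortedBlocks-heads = subst (AllPairs _<_) heads-eq
      (APP.map⁺ (AllPairs-map-∈ (map head₀ σ) (proj₁ (proj₂ σₚ))
        (λ i∈ j∈ → blockAt-monotone π π-heads (index∈ (head₀-∈-concat (proj₁ σₚ) i∈)) (index∈ (head₀-∈-concat (proj₁ σₚ) j∈)))))
      where
      heads-eq : map (λ j → head₀ (blockAt π j)) (map head₀ σ) ≡ map head₀ (map sortedBlock y)
      heads-eq = trans (sym (LP.map-∘ σ)) (trans (sym (map-cong-∈ σ head₀-sortedBlock)) (trans (LP.map-∘ σ) (LP.map-∘ y)))

    from-isColoredSetPartition : IsColoredSetPartition n (fromLevel2 y)
    from-isColoredSetPartition =
      subst (IsSetPartition n) (LP.map-∘ y)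
        ( AllP.map⁺ (All.tabulate (λ B∈ → sortedBlock-nonEmpty B∈ , CollapseBlock.S-increasing _ (block-family B∈)))
        , sortedBlocks-heads
        , ↭-trans (concatMap-↭-pointwise sortedBlock concat y (λ {B} _ → sort-↭ (concat B))) (↭-trans concat-concat-y (proj₂ (proj₂ πₚ))) ) ,
      AllP.map⁺ (All.tabulate (λ B∈ → proj₂ (CollapseBlock.collapse-colored _ (block-family B∈))))

  from-∈ : fromLevel2 y ∈ coloredSetPartitions n
  from-∈ = ∈-coloredSetPartitions⁺ n (fromLevel2 y) from-isColoredSetPartition

unique-level2 : ∀ n → Unique (level2 n)
unique-level2 n = UP.concat⁺ (AllP.map⁺ (All.tabulate (λ π∈ → unique-level2-over π∈)))
  (APP.map⁺ (AllPairs-map-∈ (SetPartitions n) (unique-SetPartitions n) disjoint))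
  where
  unique-level2-over : ∀ {π} → π ∈ SetPartitions n → Unique (map (map (map (blockAt π))) (SetPartitions (length π)))
  unique-level2-over {π} π∈ = Unique-map⁺-∈ _ (SetPartitions (length π)) (unique-SetPartitions (length π))
    (λ σ∈ σ′∈ e → trans (sym (positions σ∈)) (trans (cong (map (map (position _≟L_ π))) e) (positions σ′∈)))
    where
    positions : ∀ {σ} → σ ∈ SetPartitions (length π) → map (map (position _≟L_ π)) (map (map (blockAt π)) σ) ≡ σ
    positions {σ} σ∈ = trans (sym (LP.map-∘ σ)) (trans (LP.map-cong (λ c → sym (LP.map-∘ c)) σ)
      (map-map-id-∈ σ (λ j∈ → position-blockAt π (SortedBy⇒unique _≟L_ head₀ (APP.map⁻ (proj₁ (proj₂ (SetPartitions⇒IsSetPartition n π∈)))))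
        (PermP.∈-resp-↭ (proj₂ (proj₂ (SetPartitions⇒IsSetPartition (length π) σ∈))) j∈))))
  disjoint : ∀ {π π'} → π ∈ SetPartitions n → π' ∈ SetPartitions n → π ≢ π' →
             Disjoint (map (map (map (blockAt π))) (SetPartitions (length π))) (map (map (map (blockAt π'))) (SetPartitions (length π')))
  disjoint {π} {π'} π∈ π′∈ π≢π′ (v∈ , v∈′) with ∈-map⁻ _ v∈ | ∈-map⁻ _ v∈′
  ... | σ , σ∈ , refl | σ′ , σ′∈ , e = π≢π′ (heads-increasing-↭⇒≡
    (proj₁ (proj₂ (SetPartitions⇒IsSetPartition n π∈))) (proj₁ (proj₂ (SetPartitions⇒IsSetPartition n π′∈)))
    (↭-trans (↭-sym (FromLevel2.concat-y n π∈ σ∈)) (subst (λ t → concat t ↭ π') (sym e) (FromLevel2.concat-y n π′∈ σ′∈))))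

fromLevel2-correct : ∀ n {y} → y ∈ level2 n → (fromLevel2 y ∈ coloredSetPartitions n) × (toLevel2 (fromLevel2 y) ≡ y)
fromLevel2-correct n ym with ∈-level2⁻ n ym
... | _ , _ , π∈ , σ∈ , refl = FromLevel2.from-∈ n π∈ σ∈ , FromLevel2.to-from n π∈ σ∈

-- The blocks of all expanded blocks of x, ordered by their minima, form the set partition π of n;
-- replacing each of them by its index in π turns the expanded blocks into a set partition σ of length π.
module ToLevel2 (n : ℕ) {x : CRaw} (xₚ : IsColoredSetPartition n x) where

  private
    y : LRaw
    y = toLevel2 x

    blocks : List (List ℕ)
    blocks = concat y

    increasing-of : ∀ {s} → s ∈ x → AllPairs _<_ (proj₁ s)
    increasing-of s∈ = proj₂ (All.lookup (proj₁ (proj₁ xₚ)) (∈-map⁺ proj₁ s∈))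

    nonEmpty-of : ∀ {s} → s ∈ x → NonEmpty (proj₁ s)
    nonEmpty-of s∈ = proj₁ (All.lookup (proj₁ (proj₁ xₚ)) (∈-map⁺ proj₁ s∈))

    concat-blocks : concat blocks ↭ interval 1 n
    concat-blocks = ↭-trans (↭-reflexive (sym (LP.concat-concat y)))
      (↭-trans (↭-reflexive (cong concat (sym (LP.map-∘ x))))
      (↭-trans (concatMap-↭-pointwise (λ s → concat (expandBlock s)) proj₁ x (λ {s} _ → concat-expandBlock (proj₁ s) (proj₂ s)))
               (proj₂ (proj₂ (proj₁ xₚ)))))

    blocks-isBlock : All IsBlock blocks
    blocks-isBlock = AllP.concat⁺ (AllP.map⁺ (All.tabulate (λ s∈ → ExpandBlock.isBlock _ _ (increasing-of s∈))))

    heads : List ℕ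
    heads = map head₀ blocks

    heads-unique : Unique heads
    heads-unique = unique-heads blocks blocks-isBlock (↭-interval⇒unique concat-blocks)

    π : List (List ℕ)
    π = map (blockWithHead blocks) (sort heads)

    π-↭ : π ↭ blocks
    π-↭ = ↭-trans (PermP.map⁺ (blockWithHead blocks) (sort-↭ heads))
            (↭-reflexive (trans (sym (LP.map-∘ blocks)) (map-id-∈ blocks (blockWithHead-head₀ blocks heads-unique))))

    heads-π : map head₀ π ≡ sort heads
    heads-π = trans (sym (LP.map-∘ (sort heads))) (map-id-∈ (sort heads) (λ v∈ → head₀-blockWithHead blocks (PermP.∈-resp-↭ (sort-↭ heads) v∈)))

    πₚ : IsSetPartition n π
    πₚ = PermP.All-resp-↭ (↭-sym π-↭) blocks-isBlock ,
         subst (AllPairs _<_) (sym heads-π) (sort-increasing heads heads-unique) ,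
         ↭-trans (concat-↭ π-↭) concat-blocks

    index : List ℕ → ℕ
    index = position _≟L_ π

    ∈π : ∀ {b} → b ∈ blocks → b ∈ π
    ∈π = PermP.∈-resp-↭ (↭-sym π-↭)

    index-monotone : ∀ {a b} → a ∈ blocks → b ∈ blocks → head₀ a < head₀ b → index a < index b
    index-monotone a∈ b∈ a<b = s≤s (position₀-monotone _≟L_ head₀ π (APP.map⁻ (proj₁ (proj₂ πₚ))) (∈π a∈) (∈π b∈) a<b)

    σ : List (List ℕ)
    σ = map (map index) y

    blockAt-σ : map (map (blockAt π)) σ ≡ y
    blockAt-σ = trans (sym (LP.map-∘ y)) (trans (LP.map-cong (λ B → sym (LP.map-∘ B)) y)
      (map-map-id-∈ y (λ {b} b∈ → trans (blockAt-lookup₁ π (index b) (s≤s z≤n) (position₀<length _≟L_ π (∈π b∈)))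
                                        (lookup₁-position _≟L_ [] π b (∈π b∈)))))

    headBlock-∈ : ∀ {s} → s ∈ x → headBlock (expandBlock s) ∈ blocks
    headBlock-∈ {S , i} s∈ with expandBlock (S , i) | ExpandBlock.nonEmpty S i (increasing-of s∈) (nonEmpty-of s∈) | ∈-map⁺ expandBlock s∈
    ... | b ∷ _ | ne | B∈ = ∈-concat⁺′ (here refl) B∈

    σ-isBlock : ∀ {s} → s ∈ x → IsBlock (map index (expandBlock s))
    σ-isBlock {S , i} s∈ with expandBlock (S , i) | ExpandBlock.nonEmpty S i (increasing-of s∈) (nonEmpty-of s∈)
                            | ExpandBlock.heads-increasing S i (increasing-of s∈) | ∈-map⁺ expandBlock s∈
    ... | B@(_ ∷ _) | ne | hl | B∈ =
      ne , APP.map⁺ (AllPairs-map-∈ B (APP.map⁻ hl) (λ a∈ b∈ → index-monotone (∈-concat⁺′ a∈ B∈) (∈-concat⁺′ b∈ B∈)))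

    σ-heads : AllPairs _<_ (map head₀ σ)
    σ-heads = subst (AllPairs _<_) (sym heads-σ) (APP.map⁺ (AllPairs-map-∈ x (APP.map⁻ (APP.map⁻ (proj₁ (proj₂ (proj₁ xₚ))))) index-headBlock))
      where
      head₀-map : ∀ {s} → s ∈ x → head₀ (map index (expandBlock s)) ≡ index (headBlock (expandBlock s))
      head₀-map {S , i} s∈ with expandBlock (S , i) | ExpandBlock.nonEmpty S i (increasing-of s∈) (nonEmpty-of s∈)
      ... | _ ∷ _ | ne = refl
      heads-σ : map head₀ σ ≡ map (λ s → index (headBlock (expandBlock s))) x
      heads-σ = trans (sym (LP.map-∘ y)) (trans (sym (LP.map-∘ x)) (map-cong-∈ x head₀-map))
      index-headBlock : ∀ {s t} → s ∈ x → t ∈ x → head₀ (proj₁ s) < head₀ (proj₁ t) →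
                        index (headBlock (expandBlock s)) < index (headBlock (expandBlock t))
      index-headBlock {S , i} {T , j} s∈ t∈ S<T = index-monotone (headBlock-∈ s∈) (headBlock-∈ t∈)
        (subst₂ _<_ (sym (ExpandBlock.head₀-headBlock S i (increasing-of s∈) (nonEmpty-of s∈)))
                    (sym (ExpandBlock.head₀-headBlock T j (increasing-of t∈) (nonEmpty-of t∈))) S<T)

    concat-σ : concat σ ↭ interval 1 (length π)
    concat-σ = begin
        concat (map (map index) y)                ≡⟨ LP.concat-map y ⟩
        map index blocks                          ↭⟨ PermP.map⁺ index (↭-sym π-↭) ⟩
        map index π                               ≡⟨ LP.map-∘ π ⟩
        map suc (map (position₀ _≟L_ π) π)
          ≡⟨ cong (map suc) (map-position₀-self _≟L_ π (SortedBy⇒unique _≟L_ head₀ (APP.map⁻ (proj₁ (proj₂ πₚ))))) ⟩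
        map suc (interval 0 (length π))           ≡⟨ interval-suc 0 (length π) ⟨
        interval 1 (length π)                     ∎
      where open PermutationReasoning

    σₚ : IsSetPartition (length π) σ
    σₚ = AllP.map⁺ (AllP.map⁺ (All.tabulate σ-isBlock)) , σ-heads , concat-σ

  toLevel2-∈ : toLevel2 x ∈ level2 n
  toLevel2-∈ = subst (_∈ level2 n) blockAt-σ
    (∈-level2⁺ n π σ (IsSetPartition⇒SetPartitions n π πₚ) (IsSetPartition⇒SetPartitions (length π) σ σₚ))

toLevel2-∈-level2 : ∀ n {x} → x ∈ coloredSetPartitions n → toLevel2 x ∈ level2 n
toLevel2-∈-level2 n x∈ = ToLevel2.toLevel2-∈ n (∈-coloredSetPartitions⁻ n x∈)

from-to : ∀ x → AllColored x → fromLevel2 (toLevel2 x) ≡ x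
from-to x g = trans (sym (LP.map-∘ x)) (map-id-∈ x (λ {s} sm → collapse-expand (proj₁ s) (proj₂ s) (All.lookup g sm)))

toLevel2-injective : ∀ {x x'} → AllColored x → AllColored x' → toLevel2 x ≡ toLevel2 x' → x ≡ x'
toLevel2-injective {x} {x'} g g' e = trans (sym (from-to x g)) (trans (cong fromLevel2 e) (from-to x' g'))

level2-↭-map-toLevel2 : ∀ n → level2 n ↭ map toLevel2 (coloredSetPartitions n)
level2-↭-map-toLevel2 n = ∼bag⇒↭ (unique∧set⇒bag (unique-level2 n) image-unique (mk⇔ to from))
  where
  image-unique : Unique (map toLevel2 (coloredSetPartitions n))
  image-unique = Unique-map⁺-∈ toLevel2 _ (unique-coloredSetPartitions n)
    (λ x∈ x′∈ → toLevel2-injective (∈-coloredSetPartitions⇒AllColored n x∈) (∈-coloredSetPartitions⇒AllColored n x′∈))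
  to : ∀ {w} → w ∈ level2 n → w ∈ map toLevel2 (coloredSetPartitions n)
  to w∈ with fromLevel2-correct n w∈
  ... | from∈ , to-from = subst (_∈ map toLevel2 (coloredSetPartitions n)) to-from (∈-map⁺ toLevel2 from∈)
  from : ∀ {w} → w ∈ map toLevel2 (coloredSetPartitions n) → w ∈ level2 n
  from w∈ with ∈-map⁻ toLevel2 w∈
  ... | _ , x∈ , refl = toLevel2-∈-level2 n x∈

lints-toLevel2 : ∀ x → lints (toLevel2 x) ↭ cints x
lints-toLevel2 x = ↭-trans (↭-reflexive (cong concat (sym (LP.map-∘ x))))
  (concatMap-↭-pointwise (λ s → concatMap (λ b → b) (expandBlock s)) proj₁ x
    (λ {s} _ → ↭-trans (↭-reflexive (cong concat (LP.map-id (expandBlock s)))) (concat-expandBlock (proj₁ s) (proj₂ s))))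

size-toLevel2 : ∀ x → length (lints (toLevel2 x)) ≡ length (cints x)
size-toLevel2 x = PermP.↭-length (lints-toLevel2 x)

expandBlock-map : ∀ (h : ℕ → ℕ) S i → expandBlock (map h S , i) ≡ map (map h) (expandBlock (S , i))
expandBlock-map h [] i = refl
expandBlock-map h (s ∷ ss) i rewrite LP.length-map h ss =
  trans (LP.map-cong (λ p → LP.map-cong (λ j → lookupClamped-map h s ss (pred j)) p) P)
    (trans (LP.map-cong (λ p → LP.map-∘ p) P) (LP.map-∘ P))
  where
  P : List (List ℕ)
  P = setPartitionAt (suc (length ss)) i

toLevel2-shift : ∀ n x → toLevel2 (cshift n x) ≡ lshift n (toLevel2 x)
toLevel2-shift n x = trans (sym (LP.map-∘ x)) (trans (LP.map-cong (λ s → expandBlock-map (n +_) (proj₁ s) (proj₂ s)) x) (LP.map-∘ x))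

rank-↭ : ∀ {L L'} → L ↭ L' → ∀ v → rank L v ≡ rank L' v
rank-↭ p v = cong suc (PermP.↭-length (PermP.filter-↭ (_<? v) p))

toLevel2-std : ∀ A → lstd (toLevel2 A) ≡ toLevel2 (cstd A)
toLevel2-std A = begin
    map (map (map (rank (lints (toLevel2 A))))) (map expandBlock A)
  ≡⟨ LP.map-cong (λ B → LP.map-cong (λ b → LP.map-cong (rank-↭ (lints-toLevel2 A)) b) B) (map expandBlock A) ⟩
    map (map (map (rank (cints A)))) (map expandBlock A)
  ≡⟨ sym (LP.map-∘ A) ⟩
    map (λ s → map (map (rank (cints A))) (expandBlock s)) A
  ≡⟨ sym (LP.map-cong (λ s → expandBlock-map (rank (cints A)) (proj₁ s) (proj₂ s)) A) ⟩
    map (λ s → expandBlock (map (rank (cints A)) (proj₁ s) , proj₂ s)) A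
  ≡⟨ LP.map-∘ A ⟩
    toLevel2 (cstd A) ∎
  where open ≡-Reasoning

-- The isomorphisms

module _ {B : Set} (_≟_ : DecidableEquality B) where

  weight : B → ℚ × B → ℚ
  weight b (c , x) with x ≟ b
  ... | yes _ = c
  ... | no  _ = 0ℚ

  coeff-∷ : ∀ b p L → coeff _≟_ b (p ∷ L) ≡ weight b p ℚ.+ coeff _≟_ b L
  coeff-∷ b (c , x) L with x ≟ b
  ... | yes _ = refl
  ... | no  _ = sym (QP.+-identityˡ _)

  coeff-↭ : ∀ {L L' : Comb B} → L ↭ L' → ∀ b → coeff _≟_ b L ≡ coeff _≟_ b L'
  coeff-↭ _↭_.refl b = refl
  coeff-↭ (prep {xs} {ys} p L↭) b = begin
    coeff _≟_ b (p ∷ xs)                 ≡⟨ coeff-∷ b p xs ⟩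
    weight b p ℚ.+ coeff _≟_ b xs        ≡⟨ cong (weight b p ℚ.+_) (coeff-↭ L↭ b) ⟩
    weight b p ℚ.+ coeff _≟_ b ys        ≡⟨ coeff-∷ b p ys ⟨
    coeff _≟_ b (p ∷ ys)                 ∎
    where open ≡-Reasoning
  coeff-↭ (swap {xs} {ys} p q L↭) b = begin
    coeff _≟_ b (p ∷ q ∷ xs)                            ≡⟨ trans (coeff-∷ b p _) (cong (weight b p ℚ.+_) (coeff-∷ b q xs)) ⟩
    weight b p ℚ.+ (weight b q ℚ.+ coeff _≟_ b xs)      ≡⟨ x∙yz≈y∙xz (weight b p) (weight b q) _ ⟩
    weight b q ℚ.+ (weight b p ℚ.+ coeff _≟_ b xs)      ≡⟨ cong (λ t → weight b q ℚ.+ (weight b p ℚ.+ t)) (coeff-↭ L↭ b) ⟩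
    weight b q ℚ.+ (weight b p ℚ.+ coeff _≟_ b ys)      ≡⟨ trans (coeff-∷ b q _) (cong (weight b q ℚ.+_) (coeff-∷ b p ys)) ⟨
    coeff _≟_ b (q ∷ p ∷ ys)                            ∎
    where open ≡-Reasoning
  coeff-↭ (_↭_.trans L↭ L↭′) b = trans (coeff-↭ L↭ b) (coeff-↭ L↭′ b)

coeff-map-inj : ∀ {A B : Set} (eqA : DecidableEquality A) (eqB : DecidableEquality B) (h : A → B) a (L : Comb A) →
  (∀ {e} → e ∈ L → h (proj₂ e) ≡ h a → proj₂ e ≡ a) →
  coeff eqB (h a) (map (λ e → (proj₁ e , h (proj₂ e))) L) ≡ coeff eqA a L
coeff-map-inj eqA eqB h a [] inj = refl
coeff-map-inj eqA eqB h a ((c , v) ∷ L) inj with eqB (h v) (h a) | eqA v a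
... | yes _ | yes _ = cong (c ℚ.+_) (coeff-map-inj eqA eqB h a L (λ m → inj (there m)))
... | yes e | no nq = ⊥-elim (nq (inj (here refl) e))
... | no nq | yes e = ⊥-elim (nq (cong h e))
... | no _ | no _ = coeff-map-inj eqA eqB h a L (λ m → inj (there m))

decC : DecidableEquality CRaw
decC = CHA._≟_ (CWSym bell)

decL : DecidableEquality LRaw
decL = CHA._≟_ WSym₂

decC² : DecidableEquality (CRaw × CRaw)
decC² = CHA._≟₂_ (CWSym bell)

decL² : DecidableEquality (LRaw × LRaw)
decL² = CHA._≟₂_ WSym₂

unitTerm : ∀ {A : Set} → A → ℚ × A
unitTerm a = (1ℚ , a)

-- Both isomorphisms send a basis element indexed by x to the one indexed by toLevel2 x.
F : CRaw → Comb LRaw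
F x = unitTerm (toLevel2 x) ∷ []

G : LRaw → Comb CRaw
G y = unitTerm (fromLevel2 y) ∷ []

toLevel2² : CRaw × CRaw → LRaw × LRaw
toLevel2² p = (toLevel2 (proj₁ p) , toLevel2 (proj₂ p))

toLevel2-mul : ∀ x y → toLevel2 (x ++ cshift (length (cints x)) y) ≡ toLevel2 x ++ lshift (length (lints (toLevel2 x))) (toLevel2 y)
toLevel2-mul x y = trans (LP.map-++ expandBlock x _)
  (cong (toLevel2 x ++_) (trans (toLevel2-shift _ y) (cong (λ t → lshift t (toLevel2 y)) (sym (size-toLevel2 x)))))

toLevel2-comul : ∀ x → map (λ p → unitTerm (lstd (proj₁ p) , lstd (proj₂ p))) (splits (toLevel2 x))
                     ≡ map (λ p → unitTerm (toLevel2² (cstd (proj₁ p) , cstd (proj₂ p)))) (splits x)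
toLevel2-comul x = trans (cong (map _) (splits-map expandBlock x)) (trans (sym (LP.map-∘ (splits x)))
  (LP.map-cong (λ p → cong unitTerm (cong₂ _,_ (toLevel2-std (proj₁ p)) (toLevel2-std (proj₂ p)))) (splits x)))

F-supp : ∀ x → CHA.Valid (CWSym bell) x → All (λ p → CHA.Valid WSym₂ (proj₂ p)) (F x)
F-supp x x∈ = subst (λ n → toLevel2 x ∈ level2 n) (sym (size-toLevel2 x)) (toLevel2-∈-level2 (length (cints x)) x∈) ∷ []

G-supp : ∀ y → CHA.Valid WSym₂ y → All (λ p → CHA.Valid (CWSym bell) (proj₂ p)) (G y)
G-supp y y∈ with fromLevel2-correct (length (lints y)) y∈
... | from∈ , to-from = subst (λ n → fromLevel2 y ∈ coloredSetPartitions n)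
  (trans (cong (λ t → length (lints t)) (sym to-from)) (size-toLevel2 (fromLevel2 y))) from∈ ∷ []

G∘F : ∀ x → CHA.Valid (CWSym bell) x → _≈_ decC (lin G (F x)) ((1ℚ , x) ∷ [])
G∘F x x∈ b = cong (λ t → coeff decC b ((1ℚ , t) ∷ [])) (from-to x (∈-coloredSetPartitions⇒AllColored (length (cints x)) x∈))

F∘G : ∀ y → CHA.Valid WSym₂ y → _≈_ decL (lin F (G y)) ((1ℚ , y) ∷ [])
F∘G y y∈ b = cong (λ t → coeff decL b ((1ℚ , t) ∷ [])) (proj₂ (fromLevel2-correct (length (lints y)) y∈))

F-comul : ∀ x → (F ⊗ˡ F) (CHA.comul (CWSym bell) x) ≡ lin (CHA.comul WSym₂) (F x)
F-comul x = begin
    (F ⊗ˡ F) (CHA.comul (CWSym bell) x)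
  ≡⟨ LP.concatMap-map _ _ (splits x) ⟩
    concatMap (λ p → unitTerm (toLevel2² (cstd (proj₁ p) , cstd (proj₂ p))) ∷ []) (splits x)
  ≡⟨ concatMap-single _ (splits x) ⟩
    map (λ p → unitTerm (toLevel2² (cstd (proj₁ p) , cstd (proj₂ p)))) (splits x)
  ≡⟨ toLevel2-comul x ⟨
    map (λ p → unitTerm (lstd (proj₁ p) , lstd (proj₂ p))) (splits (toLevel2 x))
  ≡⟨ LP.map-∘ (splits (toLevel2 x)) ⟩
    scale 1ℚ (CHA.comul WSym₂ (toLevel2 x))
  ≡⟨ LP.++-identityʳ _ ⟨
    lin (CHA.comul WSym₂) (F x) ∎
  where open ≡-Reasoning

primalIso : IsHopfIso (CWSym bell) WSym₂ F G
primalIso = record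
  { f-supp  = F-supp
  ; g-supp  = G-supp
  ; unit    = λ _ → refl
  ; mult    = λ x y _ _ b → cong (λ t → coeff decL b ((1ℚ , t) ∷ [])) (toLevel2-mul x y)
  ; comult  = λ x _ b → cong (coeff decL² b) (F-comul x)
  ; counitP = λ { [] _ → refl ; (_ ∷ _) _ → refl }
  ; gf      = G∘F
  ; fg      = F∘G
  }

-- The structure constants of the duals are read off coefficients of products and coproducts
-- of the primal algebras, which toLevel2 transports because it is injective on colored partitions.
coeff-comul-toLevel2 : ∀ {x y z} → AllColored x → AllColored y → AllColored z →
  coeff decL² (toLevel2 x , toLevel2 y) (CHA.comul WSym₂ (toLevel2 z)) ≡ coeff decC² (x , y) (CHA.comul (CWSym bell) z)
coeff-comul-toLevel2 {x} {y} {z} x-col y-col z-col = begin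
    coeff decL² (toLevel2 x , toLevel2 y) (map (λ p → unitTerm (lstd (proj₁ p) , lstd (proj₂ p))) (splits (toLevel2 z)))
  ≡⟨ cong (coeff decL² (toLevel2 x , toLevel2 y)) (toLevel2-comul z) ⟩
    coeff decL² (toLevel2 x , toLevel2 y) (map (λ p → unitTerm (toLevel2² (cstd (proj₁ p) , cstd (proj₂ p)))) (splits z))
  ≡⟨ cong (coeff decL² (toLevel2 x , toLevel2 y)) (LP.map-∘ (splits z)) ⟩
    coeff decL² (toLevel2² (x , y)) (map (λ e → (proj₁ e , toLevel2² (proj₂ e))) (CHA.comul (CWSym bell) z))
  ≡⟨ coeff-map-inj decC² decL² toLevel2² (x , y) (CHA.comul (CWSym bell) z) injective ⟩
    coeff decC² (x , y) (CHA.comul (CWSym bell) z) ∎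
  where
  open ≡-Reasoning
  injective : ∀ {e} → e ∈ CHA.comul (CWSym bell) z → toLevel2² (proj₂ e) ≡ toLevel2² (x , y) → proj₂ e ≡ (x , y)
  injective e∈ eq with ∈-map⁻ _ e∈
  ... | p , p∈ , refl with All-splits z z-col p∈
  ... | l-col , r-col = cong₂ _,_ (toLevel2-injective (colored-cstd _ l-col) x-col (cong proj₁ eq))
                                  (toLevel2-injective (colored-cstd _ r-col) y-col (cong proj₂ eq))

coeff-mul-toLevel2 : ∀ {k j x y z} → x ∈ coloredSetPartitions k → y ∈ coloredSetPartitions j → AllColored z →
  coeff decL (toLevel2 z) (CHA.mul WSym₂ (toLevel2 x) (toLevel2 y)) ≡ coeff decC z (CHA.mul (CWSym bell) x y)
coeff-mul-toLevel2 {k} {j} {x} {y} {z} x∈ y∈ z-col =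
  trans (cong (λ t → coeff decL (toLevel2 z) ((1ℚ , t) ∷ [])) (sym (toLevel2-mul x y)))
        (coeff-map-inj decC decL toLevel2 z ((1ℚ , xy) ∷ []) injective)
  where
  xy : CRaw
  xy = x ++ cshift (length (cints x)) y
  injective : ∀ {e} → e ∈ (1ℚ , xy) ∷ [] → toLevel2 (proj₂ e) ≡ toLevel2 z → proj₂ e ≡ z
  injective (here refl) = toLevel2-injective
    (AllP.++⁺ (∈-coloredSetPartitions⇒AllColored k x∈) (colored-cshift _ y (∈-coloredSetPartitions⇒AllColored j y∈))) z-col

dual-mult : ∀ x y → CHA.Valid (CΠQSym bell) x → CHA.Valid (CΠQSym bell) y →
  _≈_ decL (lin F (CHA.mul (CΠQSym bell) x y)) (lin₂ (CHA.mul ΠQSym₂) (F x) (F y))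
dual-mult x y x∈ y∈ b = begin
    coeff decL b (lin F (CHA.mul (CΠQSym bell) x y))
  ≡⟨ cong (coeff decL b) lhs ⟩
    coeff decL b (map (λ z → (cC z , toLevel2 z)) (coloredSetPartitions n))
  ≡⟨ cong (coeff decL b) (map-cong-∈ (coloredSetPartitions n) (λ {z} z∈ →
       cong (_, toLevel2 z) (coeff-comul-toLevel2 x-col y-col (∈-coloredSetPartitions⇒AllColored n z∈)))) ⟨
    coeff decL b (map (λ z → (cL (toLevel2 z) , toLevel2 z)) (coloredSetPartitions n))
  ≡⟨ cong (coeff decL b) (LP.map-∘ (coloredSetPartitions n)) ⟩
    coeff decL b (map (λ w → (cL w , w)) (map toLevel2 (coloredSetPartitions n)))
  ≡⟨ coeff-↭ decL (PermP.map⁺ (λ w → (cL w , w)) (level2-↭-map-toLevel2 n)) b ⟨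
    coeff decL b (map (λ w → (cL w , w)) (level2 n))
  ≡⟨ cong (λ t → coeff decL b (map (λ w → (cL w , w)) (level2 t))) sizes ⟨
    coeff decL b (map (λ w → (cL w , w)) (level2 (length (lints (toLevel2 x)) + length (lints (toLevel2 y)))))
  ≡⟨ cong (coeff decL b) rhs ⟨
    coeff decL b (lin₂ (CHA.mul ΠQSym₂) (F x) (F y)) ∎
  where
  open ≡-Reasoning
  n : ℕ
  n = length (cints x) + length (cints y)
  sizes : length (lints (toLevel2 x)) + length (lints (toLevel2 y)) ≡ n
  sizes = cong₂ _+_ (size-toLevel2 x) (size-toLevel2 y)
  x-col : AllColored x
  x-col = ∈-coloredSetPartitions⇒AllColored (length (cints x)) x∈
  y-col : AllColored y
  y-col = ∈-coloredSetPartitions⇒AllColored (length (cints y)) y∈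
  cC : CRaw → ℚ
  cC z = coeff decC² (x , y) (CHA.comul (CWSym bell) z)
  cL : LRaw → ℚ
  cL w = coeff decL² (toLevel2 x , toLevel2 y) (CHA.comul WSym₂ w)
  lhs : lin F (CHA.mul (CΠQSym bell) x y) ≡ map (λ z → (cC z , toLevel2 z)) (coloredSetPartitions n)
  lhs = trans (LP.concatMap-map _ _ (coloredSetPartitions n))
    (trans (concatMap-single (λ z → (cC z ℚ.* 1ℚ , toLevel2 z)) (coloredSetPartitions n))
           (LP.map-cong (λ z → cong (_, toLevel2 z) (QP.*-identityʳ (cC z))) (coloredSetPartitions n)))
  rhs : lin₂ (CHA.mul ΠQSym₂) (F x) (F y) ≡ map (λ w → (cL w , w)) (level2 (length (lints (toLevel2 x)) + length (lints (toLevel2 y))))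
  rhs = trans (LP.++-identityʳ _) (trans (LP.++-identityʳ _)
    (trans (LP.map-cong (λ p → cong (_, proj₂ p) (QP.*-identityˡ (proj₁ p))) _) (LP.map-id _)))

module DualComultiplication (z : CRaw) (z∈ : CHA.Valid (CΠQSym bell) z) where

  private
    n : ℕ
    n = length (cints z)

    cC : CRaw → CRaw → ℚ
    cC x y = coeff decC z (CHA.mul (CWSym bell) x y)

    cL : LRaw → LRaw → ℚ
    cL u v = coeff decL (toLevel2 z) (CHA.mul WSym₂ u v)

    termsC : ℕ → List (ℚ × (LRaw × LRaw))
    termsC k = concatMap (λ x → map (λ y → (cC x y , toLevel2² (x , y))) (coloredSetPartitions (n ∸ k))) (coloredSetPartitions k)

    termsL : ℕ → ℕ → List (ℚ × (LRaw × LRaw))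
    termsL t k = concatMap (λ u → map (λ v → (cL u v , (u , v))) (level2 (t ∸ k))) (level2 k)

    termsL-↭ : ∀ k → termsL n k ↭ termsC k
    termsL-↭ k = begin
        termsL n k
      ↭⟨ concatMap-↭ (λ u → map (λ v → (cL u v , (u , v))) (level2 j)) (level2-↭-map-toLevel2 k) ⟩
        concatMap (λ u → map (λ v → (cL u v , (u , v))) (level2 j)) (map toLevel2 (coloredSetPartitions k))
      ≡⟨ LP.concatMap-map _ toLevel2 (coloredSetPartitions k) ⟩
        concatMap (λ x → map (λ v → (cL (toLevel2 x) v , (toLevel2 x , v))) (level2 j)) (coloredSetPartitions k)
      ↭⟨ concatMap-↭-pointwise _ _ (coloredSetPartitions k)
           (λ {x} _ → PermP.map⁺ (λ v → (cL (toLevel2 x) v , (toLevel2 x , v))) (level2-↭-map-toLevel2 j)) ⟩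
        concatMap (λ x → map (λ v → (cL (toLevel2 x) v , (toLevel2 x , v))) (map toLevel2 (coloredSetPartitions j))) (coloredSetPartitions k)
      ≡⟨ cong concat (LP.map-cong (λ x → sym (LP.map-∘ (coloredSetPartitions j))) (coloredSetPartitions k)) ⟩
        concatMap (λ x → map (λ y → (cL (toLevel2 x) (toLevel2 y) , toLevel2² (x , y))) (coloredSetPartitions j)) (coloredSetPartitions k)
      ≡⟨ cong concat (map-cong-∈ (coloredSetPartitions k) (λ {x} x∈ → map-cong-∈ (coloredSetPartitions j) (λ {y} y∈ →
           cong (_, toLevel2² (x , y)) (coeff-mul-toLevel2 {k} {j} x∈ y∈ (∈-coloredSetPartitions⇒AllColored n z∈))))) ⟩
        termsC k ∎
      where
      open PermutationReasoning
      j : ℕ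
      j = n ∸ k

    lhs : (F ⊗ˡ F) (CHA.comul (CΠQSym bell) z) ≡ concatMap termsC (upTo (suc n))
    lhs = begin
        (F ⊗ˡ F) (CHA.comul (CΠQSym bell) z)
      ≡⟨ concatMap-single (λ e → (proj₁ e ℚ.* 1ℚ , toLevel2² (proj₂ e))) (CHA.comul (CΠQSym bell) z) ⟩
        map (λ e → (proj₁ e ℚ.* 1ℚ , toLevel2² (proj₂ e))) (CHA.comul (CΠQSym bell) z)
      ≡⟨ LP.map-cong (λ e → cong (_, toLevel2² (proj₂ e)) (QP.*-identityʳ (proj₁ e))) (CHA.comul (CΠQSym bell) z) ⟩
        map (λ e → (proj₁ e , toLevel2² (proj₂ e))) (CHA.comul (CΠQSym bell) z)
      ≡⟨ LP.map-concatMap _ _ (upTo (suc n)) ⟩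
        concatMap (λ k → map (λ e → (proj₁ e , toLevel2² (proj₂ e)))
          (concatMap (λ x → map (λ y → (cC x y , (x , y))) (coloredSetPartitions (n ∸ k))) (coloredSetPartitions k))) (upTo (suc n))
      ≡⟨ LP.concatMap-cong (λ k → trans (LP.map-concatMap _ _ (coloredSetPartitions k))
           (LP.concatMap-cong (λ x → sym (LP.map-∘ (coloredSetPartitions (n ∸ k)))) (coloredSetPartitions k))) (upTo (suc n)) ⟩
        concatMap termsC (upTo (suc n)) ∎
      where open ≡-Reasoning

    rhs : lin (CHA.comul ΠQSym₂) (F z) ≡ concatMap (termsL n) (upTo (suc n))
    rhs = trans (LP.++-identityʳ _) (trans (LP.map-cong (λ p → cong (_, proj₂ p) (QP.*-identityˡ (proj₁ p))) _)
            (trans (LP.map-id _) (cong (λ t → concatMap (termsL t) (upTo (suc t))) (size-toLevel2 z))))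

  dual-comult : _≈_ decL² ((F ⊗ˡ F) (CHA.comul (CΠQSym bell) z)) (lin (CHA.comul ΠQSym₂) (F z))
  dual-comult b = trans (cong (coeff decL² b) lhs)
    (trans (sym (coeff-↭ decL² (concatMap-↭-pointwise (termsL n) termsC (upTo (suc n)) (λ {k} _ → termsL-↭ k)) b))
           (cong (coeff decL² b) (sym rhs)))

dualIso : IsHopfIso (CΠQSym bell) ΠQSym₂ F G
dualIso = record
  { f-supp  = F-supp
  ; g-supp  = G-supp
  ; unit    = λ _ → refl
  ; mult    = dual-mult
  ; comult  = DualComultiplication.dual-comult
  ; counitP = λ { [] _ → refl ; (_ ∷ _) _ → refl }
  ; gf      = G∘F
  ; fg      = F∘G
  }

mainTheorem4 : HopfIsomorphic (CWSym bell) WSym₂ × HopfIsomorphic (CΠQSym bell) ΠQSym₂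
mainTheorem4 = (F , G , primalIso) , (F , G , dualIso)
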